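{- Let $F$ be a field of characteristic $p>0$, let $\pi$ be an $n$-fold quasi-Pfister form over $F$, $\sigma$ a subform of $\pi$, and $d\in F^*$ such that the quasilinear $p$-form $\varphi\simeq\pi\perp d\sigma$ is anisotropic. Then \[\{\dim(\varphi_E)_{an}\mid E/F\text{ a field extension}\}\subseteq\{p^k+\ell\mid 0\leq k\leq n,\ 0\leq\ell\leq\dim\sigma\}.\]
   Context: A quasilinear $p$-form over $F$ ($\mathrm{char}\,F=p$) is a map $\varphi:V\to F$ on a finite-dimensional $F$-vector space with $\varphi(av)=a^p\varphi(v)$, $\varphi(v+w)=\varphi(v)+\varphi(w)$; $\langle c_1,\dots,c_n\rangle$ denotes $\sum c_iX_i^p$, $\perp$ is concatenation, $c\langle c_1,\dots,c_n\rangle=\langle cc_1,\dots,cc_n\rangle$, $\langle c_i\rangle\otimes\langle d_j\rangle=\langle c_id_j\rangle_{i,j}$. Subform: injective linear map between underlying spaces compatible with the forms. Anisotropic: $\varphi(v)=0$ implies $v=0$; $\varphi\simeq\varphi_{an}\perp k\times\langle0\rangle$ with $\varphi_{an}$ anisotropic (anisotropic part). For $E/F$, $\varphi_E(e\otimes v)=e^p\varphi(v)$ on $E\otimes_FV$. An $n$-fold quasi-Pfister form is $\langle\langle a_1,\dots,a_n\rangle\rangle=\langle\langle a_1\rangle\rangle\otimes\cdots\otimes\langle\langle a_n\rangle\rangle$, $\langle\langle a\rangle\rangle=\langle1,a,\dots,a^{p-1}\rangle$. -}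

module Defs where

open import Level using (Level; _⊔_)
open import Algebra.Bundles using (CommutativeRing)
open import Algebra.Morphism.Structures using (module RingMorphisms)
open import Data.Nat using (ℕ; zero; suc)
open import Data.Fin using (Fin)
open import Data.List using (List; []; _∷_; map; concatMap; length; lookup; upTo; replicate; _++_)
open import Data.Product using (Σ; ∃; _×_)
open import Relation.Nullary using (¬_)
open import Data.Vec using (Vec; toList)

record Field (c ℓ : Level) : Set (Level.suc (c ⊔ ℓ)) where
  field
    commutativeRing : CommutativeRing c ℓ
  open CommutativeRing commutativeRing public
  field
    1≉0     : ¬ (1# ≈ 0#)
    inverse : ∀ x → ¬ (x ≈ 0#) → Σ Carrier λ y → x * y ≈ 1#

-- Field extensions E/F: a field E together with a (unital) ring
-- homomorphism F → E (automatically injective).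

record Extension {c ℓ : Level} (F : Field c ℓ) (c' ℓ' : Level)
       : Set (c ⊔ ℓ ⊔ Level.suc (c' ⊔ ℓ')) where
  field
    E     : Field c' ℓ'
    ι     : Field.Carrier F → Field.Carrier E
    isHom : RingMorphisms.IsRingHomomorphism
              (CommutativeRing.rawRing (Field.commutativeRing F))
              (CommutativeRing.rawRing (Field.commutativeRing E)) ι

-- Every quasilinear p-form on a finite-dimensional space is diagonal
-- w.r.t. any basis, so a form is represented by its list of diagonal
-- coefficients  ⟨c₁,…,cₙ⟩ = Σ cᵢ Xᵢ^p  on K^n (vectors = Fin n → K).

module Forms {c ℓ : Level} (K : Field c ℓ) where
  open Field K

  _×1 : ℕ → Carrier
  zero ×1  = 0#
  suc n ×1 = 1# + n ×1

  HasChar : ℕ → Set ℓ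
  HasChar p = (p ×1) ≈ 0#

  pow : Carrier → ℕ → Carrier
  pow x zero    = 1#
  pow x (suc k) = x * pow x k

  Σᶠ : ∀ {n} → (Fin n → Carrier) → Carrier
  Σᶠ {zero}  f = 0#
  Σᶠ {suc n} f = f Fin.zero + Σᶠ (λ i → f (Fin.suc i))

  QForm : Set c
  QForm = List Carrier

  dim : QForm → ℕ
  dim = length

  Vect : QForm → Set c
  Vect φ = Fin (dim φ) → Carrier

  eval : (p : ℕ) (φ : QForm) → Vect φ → Carrier
  eval p φ x = Σᶠ λ i → lookup φ i * pow (x i) p

  IsZeroVec : ∀ {n} → (Fin n → Carrier) → Set ℓ
  IsZeroVec v = ∀ i → v i ≈ 0#

  Matrix : ℕ → ℕ → Set c
  Matrix n m = Fin n → Fin m → Carrier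

  apply : ∀ {n m} → Matrix n m → (Fin m → Carrier) → Fin n → Carrier
  apply A x i = Σᶠ λ j → A i j * x j

  _⊥_ : QForm → QForm → QForm
  _⊥_ = _++_

  _·_ : Carrier → QForm → QForm
  d · φ = map (d *_) φ

  _⊗_ : QForm → QForm → QForm
  φ ⊗ ψ = concatMap (λ a → map (a *_) ψ) φ

  zeros : ℕ → QForm
  zeros k = replicate k 0#

  pf1 : (p : ℕ) → Carrier → QForm
  pf1 p a = map (pow a) (upTo p)

  pfister : (p : ℕ) → List Carrier → QForm
  pfister p []       = 1# ∷ []
  pfister p (a ∷ as) = pf1 p a ⊗ pfister p as

  Anisotropic : (p : ℕ) → QForm → Set (c ⊔ ℓ)
  Anisotropic p φ = ∀ (x : Vect φ) → eval p φ x ≈ 0# → IsZeroVec x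

  Isometric : (p : ℕ) → QForm → QForm → Set (c ⊔ ℓ)
  Isometric p φ ψ =
    Σ (Matrix (dim ψ) (dim φ)) λ M →
    Σ (Matrix (dim φ) (dim ψ)) λ N →
      (∀ x i → apply N (apply M x) i ≈ x i) ×
      (∀ y j → apply M (apply N y) j ≈ y j) ×
      (∀ x → eval p ψ (apply M x) ≈ eval p φ x)

  Subform : (p : ℕ) → QForm → QForm → Set (c ⊔ ℓ)
  Subform p σ π =
    Σ (Matrix (dim π) (dim σ)) λ A →
      (∀ x → IsZeroVec (apply A x) → IsZeroVec x) ×
      (∀ x → eval p π (apply A x) ≈ eval p σ x)

  IsQuasiPfister : (p n : ℕ) → QForm → Set (c ⊔ ℓ)
  IsQuasiPfister p n π =
    Σ (Vec Carrier n) λ as → Isometric p (pfister p (toList as)) π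

baseChange : ∀ {c ℓ c' ℓ'} {F : Field c ℓ} (L : Extension F c' ℓ') →
             Forms.QForm F → Forms.QForm (Extension.E L)
baseChange L φ = map (Extension.ι L) φ

module Submission where

-- View E as a vector space over its subfield E^p. The values of a quasilinear p-form
-- make up the E^p-span of its coefficients, and the coefficients of an anisotropic form
-- are E^p-independent, so dim (φ_E)_an is the dimension of ⟨φ_E⟩ = ⟨π_E⟩ + ⟨dσ_E⟩.
-- For π = ⟨⟨a₁,…,aₙ⟩⟩ the span ⟨π_E⟩ is the field E^p(a₁,…,aₙ): adjoining the aᵢ one
-- at a time either changes nothing or multiplies the dimension by p, since for α ∉ K
-- with α^p ∈ K the powers 1, α, …, α^(p-1) are K-independent (a shorter relation gives a
-- polynomial over K dividing (X − α)^p, refuted by evaluating at α + s with s^p = 0).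
-- Hence dim ⟨π_E⟩ = p^k with k ≤ n, and Steinitz exchange gives
-- p^k ≤ dim (φ_E)_an ≤ p^k + dim σ. Equality in E is not decidable, so the argument runs
-- in the double-negation monad; the conclusion is decidable and is extracted at the end.

open import Level using (Level; _⊔_) renaming (suc to lsuc)
open import Data.Nat as ℕ using (ℕ; zero; suc; _∸_; _≤_; _<_; z≤n; s≤s; _!; _≤?_)
import Data.Nat.Properties as ℕP
open import Data.Nat.Primality using (Prime; euclidsLemma)
import Data.Nat.Coprimality as Coprime
import Data.Nat.GCD as GCD
open import Data.Fin using (Fin; zero; suc; toℕ; fromℕ; inject₁)
open import Data.Fin.Properties using (toℕ-inject₁; toℕ-fromℕ; toℕ<n)
open import Data.List using (List; []; _∷_; _++_; length; map; replicate; concat; applyUpTo; upTo; lookup; tabulate)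
import Data.List.Properties as List
open import Data.List.Relation.Unary.All as All using (All; []; _∷_)
import Data.List.Relation.Unary.All.Properties as All
open import Data.List.Relation.Unary.Any as Any using (Any; here; there)
import Data.List.Relation.Unary.Any.Properties as Any
open import Data.List.Relation.Binary.Pointwise as Pointwise using (Pointwise; []; _∷_)
open import Data.Vec as Vec using (Vec; []; _∷_; toList)
import Data.Vec.Properties as VecP
open import Data.Product using (Σ; _×_; _,_; proj₁; proj₂)
open import Data.Sum using (_⊎_; inj₁; inj₂)
open import Data.Empty using (⊥; ⊥-elim)
open import Relation.Nullary using (¬_; Dec; yes; no)
open import Relation.Nullary.Negation using (DoubleNegation; ¬¬-map)
open import Relation.Nullary.Decidable using (¬¬-excluded-middle; decidable-stable)
open import Relation.Binary.PropositionalEquality as ≡ using (_≡_)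
open import Algebra.Bundles using (CommutativeRing)
open import Algebra.Structures using (IsCommutativeRing)
open import Algebra.Morphism.Structures using (module RingMorphisms)
open import Function using (case_of_)
import Algebra.Properties.Semiring.Exp
open import Defs

module DoubleNegationMonad where

  _>>=_ : ∀ {a b} {A : Set a} {B : Set b} →
          DoubleNegation A → (A → DoubleNegation B) → DoubleNegation B
  (¬¬a >>= f) ¬b = ¬¬a (λ a → f a ¬b)

  ¬¬-all : ∀ {a p} {A : Set a} {P : A → Set p} {xs : List A} →
           All (λ x → DoubleNegation (P x)) xs → DoubleNegation (All P xs)
  ¬¬-all []         = λ k → k []
  ¬¬-all (¬¬p ∷ ¬¬ps) = ¬¬p >>= λ p → ¬¬-map (p ∷_) (¬¬-all ¬¬ps)

module PrimeBinomial where
  open import Data.Nat.Divisibility using (_∣_; divides; ∣1⇒≡1; ∣⇒≤)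
  open import Data.Nat.DivMod using (m/n*n≡m)
  open import Data.Nat.Combinatorics using (_C_; k![n∸k]!∣n!; nCk≡n!/k![n-k]!)

  prime⇒2≤ : ∀ {p} → Prime p → 2 ≤ p
  prime⇒2≤ {suc (suc _)} _ = s≤s (s≤s z≤n)

  prime⇒0< : ∀ {p} → Prime p → 0 < p
  prime⇒0< {suc _} _ = s≤s z≤n

  prime≡1+pred : ∀ {p} → Prime p → p ≡ suc (ℕ.pred p)
  prime≡1+pred {suc _} _ = ≡.refl

  prime∤! : ∀ {p} → Prime p → ∀ j → j < p → ¬ (p ∣ j !)
  prime∤! pp zero j<p p∣1 with ∣1⇒≡1 p∣1
  ... | ≡.refl with prime⇒2≤ pp
  ... | s≤s ()
  prime∤! pp (suc j) j<p p∣j! with euclidsLemma (suc j) (j !) pp p∣j!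
  ... | inj₁ p∣1+j = ℕP.<⇒≱ j<p (∣⇒≤ p∣1+j)
  ... | inj₂ p∣j!′ = prime∤! pp j (ℕP.<-trans (ℕP.n<1+n j) j<p) p∣j!′

  n∣n! : ∀ {n} → 0 < n → n ∣ n !
  n∣n! {suc n} _ = divides (n !) (ℕP.*-comm (suc n) (n !))

  prime∣choose : ∀ {p k} → Prime p → 0 < k → k < p → p ∣ p C k
  prime∣choose {p} {k} pp 0<k k<p with euclidsLemma (p C k) d pp p∣C*d
    where
    d = k ! ℕ.* (p ∸ k) !
    instance
      d≢0 : ℕ.NonZero d
      d≢0 = k ℕP.!* (p ∸ k) !≢0
    C*d≡p! : (p C k) ℕ.* d ≡ p !
    C*d≡p! = ≡.trans (≡.cong (ℕ._* d) (nCk≡n!/k![n-k]! (ℕP.<⇒≤ k<p))) (m/n*n≡m (k![n∸k]!∣n! (ℕP.<⇒≤ k<p)))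
    p∣C*d : p ∣ (p C k) ℕ.* d
    p∣C*d = ≡.subst (p ∣_) (≡.sym C*d≡p!) (n∣n! (prime⇒0< pp))
  ... | inj₁ p∣C = p∣C
  ... | inj₂ p∣d with euclidsLemma (k !) ((p ∸ k) !) pp p∣d
  ... | inj₁ p∣k! = ⊥-elim (prime∤! pp k k<p p∣k!)
  ... | inj₂ p∣[p-k]! = ⊥-elim (prime∤! pp (p ∸ k) (ℕP.∸-monoʳ-< 0<k (ℕP.<⇒≤ k<p)) p∣[p-k]!)

module Frobenius {c ℓ} (R : CommutativeRing c ℓ) where
  open CommutativeRing R hiding (zero)
  open import Algebra.Properties.Semiring.Exp semiring public using (_^_; ^-congˡ; ^-homo-*)
  open import Algebra.Properties.Monoid.Mult +-monoid using (×-assocˡ; ×-congʳ) renaming (_×_ to _×ₙ_)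
  open import Algebra.Properties.Semiring.Mult semiring using (×-assoc-*)
  open import Algebra.Properties.Monoid.Sum +-monoid using (sum)
  open import Data.Nat.Divisibility using (divides)
  open import Data.Nat.Combinatorics using (_C_; nCn≡1)
  open import Algebra.Properties.CommutativeSemiring.Binomial commutativeSemiring
    using () renaming (theorem to binomial-theorem)
  open import Relation.Binary.Reasoning.Setoid setoid

  ×-zero : ∀ n → n ×ₙ 0# ≈ 0#
  ×-zero zero    = refl
  ×-zero (suc n) = trans (+-identityˡ _) (×-zero n)

  sum≈last : ∀ m (f : Fin (suc m) → Carrier) →
             (∀ i → f (inject₁ i) ≈ 0#) → sum f ≈ f (fromℕ m)
  sum≈last zero    f _  = +-identityʳ (f zero)
  sum≈last (suc m) f f0 = begin
    f zero + sum (λ i → f (suc i)) ≈⟨ +-cong (f0 zero) (sum≈last m (λ i → f (suc i)) (λ i → f0 (suc i))) ⟩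
    0# + f (fromℕ (suc m))         ≈⟨ +-identityˡ _ ⟩
    f (fromℕ (suc m))              ∎

  multiple-of-char×≈0 : ∀ {p} → p ×ₙ 1# ≈ 0# → ∀ q x → (q ℕ.* p) ×ₙ x ≈ 0#
  multiple-of-char×≈0 {p} char q x = begin
    (q ℕ.* p) ×ₙ x  ≈⟨ ×-assocˡ x q p ⟨
    q ×ₙ (p ×ₙ x)   ≈⟨ ×-congʳ q p×x≈0 ⟩
    q ×ₙ 0#         ≈⟨ ×-zero q ⟩
    0#              ∎
    where
    p×x≈0 : p ×ₙ x ≈ 0#
    p×x≈0 = begin
      p ×ₙ x         ≈⟨ ×-congʳ p (*-identityˡ x) ⟨
      p ×ₙ (1# * x)  ≈⟨ ×-assoc-* p 1# x ⟨
      (p ×ₙ 1#) * x  ≈⟨ *-congʳ char ⟩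
      0# * x         ≈⟨ zeroˡ x ⟩
      0#             ∎

  frobenius-+ : ∀ {p} → Prime p → p ×ₙ 1# ≈ 0# → ∀ x y → (x + y) ^ p ≈ x ^ p + y ^ p
  frobenius-+ {p@(suc (suc m))} pp char x y = begin
    (x + y) ^ p                 ≈⟨ binomial-theorem p x y ⟩
    sum term                    ≈⟨ +-congˡ (sum≈last (suc m) (λ i → term (suc i)) interior≈0) ⟩
    term zero + term (fromℕ p)  ≈⟨ +-cong first last ⟩
    y ^ p + x ^ p               ≈⟨ +-comm _ _ ⟩
    x ^ p + y ^ p               ∎
    where
    term : Fin (suc p) → Carrier
    term k = (p C toℕ k) ×ₙ (x ^ toℕ k * y ^ (p ∸ toℕ k))
    first : term zero ≈ y ^ p
    first = trans (+-identityʳ _) (*-identityˡ _)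
    last : term (fromℕ p) ≈ x ^ p
    last rewrite toℕ-fromℕ m | nCn≡1 p | ℕP.n∸n≡0 m = trans (+-identityʳ _) (*-identityʳ _)
    interior≈0 : ∀ i → term (suc (inject₁ i)) ≈ 0#
    interior≈0 i with PrimeBinomial.prime∣choose {k = suc (toℕ (inject₁ i))} pp (s≤s z≤n)
                        (s≤s (≡.subst (ℕ._< suc m) (≡.sym (toℕ-inject₁ i)) (toℕ<n i)))
    ... | divides q C≡q*p =
      ≡.subst (λ n → n ×ₙ (x ^ k * y ^ (p ∸ k)) ≈ 0#) (≡.sym C≡q*p) (multiple-of-char×≈0 char q _)
      where k = suc (toℕ (inject₁ i))

open DoubleNegationMonad

module RingLemmas {c ℓ} (R : CommutativeRing c ℓ) where
  open CommutativeRing R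
  open import Algebra.Properties.AbelianGroup +-abelianGroup public
    using (⁻¹-involutive; ⁻¹-∙-comm; ε⁻¹≈ε; inverseˡ-unique; x∙y⁻¹≈ε⇒x≈y)
  open import Algebra.Properties.Ring ring public using (-‿distribˡ-*; -‿distribʳ-*)
  open import Algebra.Properties.CommutativeSemigroup +-commutativeSemigroup public
    using () renaming (interchange to +-interchange)
  open import Algebra.Properties.CommutativeSemigroup *-commutativeSemigroup public
    using () renaming (interchange to *-interchange; x∙yz≈y∙xz to *-left-comm)

  x≈x+y-y : ∀ x y → x ≈ (x + y) - y
  x≈x+y-y x y = sym (trans (+-assoc x y (- y)) (trans (+-congˡ (-‿inverseʳ y)) (+-identityʳ x)))

module PaddedSum {a} {A : Set a} (_+_ : A → A → A) where

  infixl 6 _⊞_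
  _⊞_ : List A → List A → List A
  []       ⊞ ys       = ys
  (x ∷ xs) ⊞ []       = x ∷ xs
  (x ∷ xs) ⊞ (y ∷ ys) = (x + y) ∷ (xs ⊞ ys)

-- The field E viewed as a vector space over its subfield E^p: a list L of
-- elements spans { Σ xᵢ^p Lᵢ }, and the coefficients xᵢ are stored as the
-- p-th roots of the actual E^p-scalars.
module Eᵖ-Linear {c ℓ} (E : Field c ℓ) {p : ℕ} (pp : Prime p) (char : Forms.HasChar E p) where
  open Field E hiding (zero)
  open Frobenius commutativeRing public using (_^_; ^-congˡ; ^-homo-*)
  open import Algebra.Properties.Monoid.Mult +-monoid using (×-homo-+; ×-assocˡ; ×-congʳ) renaming (_×_ to _×ₙ_)
  open import Algebra.Properties.CommutativeSemiring.Exp commutativeSemiring public using (^-distrib-*)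
  open import Relation.Binary.Reasoning.Setoid setoid
  open RingLemmas commutativeRing public
  open PaddedSum _+_ public

  ×1≡× : ∀ n → Forms._×1 E n ≡ n ×ₙ 1#
  ×1≡× zero    = ≡.refl
  ×1≡× (suc n) = ≡.cong (1# +_) (×1≡× n)

  char× : p ×ₙ 1# ≈ 0#
  char× = ≡.subst (_≈ 0#) (×1≡× p) char

  pow≡^ : ∀ x k → Forms.pow E x k ≡ x ^ k
  pow≡^ x zero    = ≡.refl
  pow≡^ x (suc k) = ≡.cong (x *_) (pow≡^ x k)

  ^p-+ : ∀ x y → (x + y) ^ p ≈ x ^ p + y ^ p
  ^p-+ = Frobenius.frobenius-+ commutativeRing pp char×

  ^p-* : ∀ x y → (x * y) ^ p ≈ x ^ p * y ^ p
  ^p-* x y = ^-distrib-* x y p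

  0^n : ∀ {n} → 0 < n → 0# ^ n ≈ 0#
  0^n {suc n} _ = zeroˡ _

  0^p : 0# ^ p ≈ 0#
  0^p = 0^n (PrimeBinomial.prime⇒0< pp)

  1^n : ∀ n → 1# ^ n ≈ 1#
  1^n zero    = refl
  1^n (suc n) = trans (*-identityˡ _) (1^n n)

  -^p : ∀ x → (- x) ^ p ≈ - (x ^ p)
  -^p x = inverseˡ-unique _ _ (begin
    (- x) ^ p + x ^ p  ≈⟨ ^p-+ (- x) x ⟨
    (- x + x) ^ p      ≈⟨ ^-congˡ p (-‿inverseˡ x) ⟩
    0# ^ p             ≈⟨ 0^p ⟩
    0#                 ∎)

  ^p≈0⇒¬¬≈0 : ∀ x → x ^ p ≈ 0# → DoubleNegation (x ≈ 0#)
  ^p≈0⇒¬¬≈0 x xᵖ≈0 x≉0 with inverse x x≉0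
  ... | y , xy≈1 = 1≉0 (begin
    1#              ≈⟨ 1^n p ⟨
    1# ^ p          ≈⟨ ^-congˡ p xy≈1 ⟨
    (x * y) ^ p     ≈⟨ ^p-* x y ⟩
    x ^ p * y ^ p   ≈⟨ *-congʳ xᵖ≈0 ⟩
    0# * y ^ p      ≈⟨ zeroˡ _ ⟩
    0#              ∎)

  multiple×1≈0 : ∀ {n} a → n ×ₙ 1# ≈ 0# → (a ℕ.* n) ×ₙ 1# ≈ 0#
  multiple×1≈0 {n} a n≈0 =
    trans (sym (×-assocˡ 1# a n)) (trans (×-congʳ a n≈0) (Frobenius.×-zero commutativeRing a))

  ×1-succ≈0⇒1≈0 : ∀ a b → 1 ℕ.+ a ≡ b → a ×ₙ 1# ≈ 0# → b ×ₙ 1# ≈ 0# → 1# ≈ 0#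
  ×1-succ≈0⇒1≈0 a b eq a≈0 b≈0 = begin
    1#                 ≈⟨ +-identityʳ 1# ⟨
    1# + 0#            ≈⟨ +-cong (+-identityʳ 1#) a≈0 ⟨
    1 ×ₙ 1# + a ×ₙ 1#  ≈⟨ ×-homo-+ 1# 1 a ⟨
    (1 ℕ.+ a) ×ₙ 1#    ≡⟨ ≡.cong (_×ₙ 1#) eq ⟩
    b ×ₙ 1#            ≈⟨ b≈0 ⟩
    0#                 ∎

  -- a Bézout identity between j and p turns j·1 = 0 into 1 = 0
  ×1≉0 : ∀ j → 0 < j → j < p → ¬ (j ×ₙ 1# ≈ 0#)
  ×1≉0 j@(suc _) _ j<p j≈0 with Coprime.coprime-Bézout (Coprime.prime⇒coprime pp j<p)
  ... | GCD.Bézout.+- x y eq = 1≉0 (×1-succ≈0⇒1≈0 _ _ eq (multiple×1≈0 y j≈0) (multiple×1≈0 x char×))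
  ... | GCD.Bézout.-+ x y eq = 1≉0 (×1-succ≈0⇒1≈0 _ _ eq (multiple×1≈0 x char×) (multiple×1≈0 y j≈0))

  comb : List Carrier → List Carrier → Carrier
  comb []      _        = 0#
  comb (v ∷ L) []       = 0#
  comb (v ∷ L) (x ∷ xs) = x ^ p * v + comb L xs

  comb-[] : ∀ L → comb L [] ≈ 0#
  comb-[] []      = refl
  comb-[] (v ∷ L) = refl

  comb-⊞ : ∀ L xs ys → comb L (xs ⊞ ys) ≈ comb L xs + comb L ys
  comb-⊞ []      xs       ys       = sym (+-identityˡ _)
  comb-⊞ (v ∷ L) []       ys       = sym (+-identityˡ _)
  comb-⊞ (v ∷ L) (x ∷ xs) []       = sym (+-identityʳ _)
  comb-⊞ (v ∷ L) (x ∷ xs) (y ∷ ys) = begin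
    (x + y) ^ p * v + comb L (xs ⊞ ys)                 ≈⟨ +-cong (trans (*-congʳ (^p-+ x y)) (distribʳ v _ _)) (comb-⊞ L xs ys) ⟩
    (x ^ p * v + y ^ p * v) + (comb L xs + comb L ys)  ≈⟨ +-interchange _ _ _ _ ⟩
    (x ^ p * v + comb L xs) + (y ^ p * v + comb L ys)  ∎

  comb-scale : ∀ L a xs → comb L (map (a *_) xs) ≈ a ^ p * comb L xs
  comb-scale []      a xs       = sym (zeroʳ _)
  comb-scale (v ∷ L) a []       = sym (zeroʳ _)
  comb-scale (v ∷ L) a (x ∷ xs) = begin
    (a * x) ^ p * v + comb L (map (a *_) xs)   ≈⟨ +-cong (trans (*-congʳ (^p-* a x)) (*-assoc _ _ _)) (comb-scale L a xs) ⟩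
    a ^ p * (x ^ p * v) + a ^ p * comb L xs    ≈⟨ distribˡ _ _ _ ⟨
    a ^ p * (x ^ p * v + comb L xs)            ∎

  comb-neg : ∀ L xs → comb L (map -_ xs) ≈ - comb L xs
  comb-neg []      xs       = sym ε⁻¹≈ε
  comb-neg (v ∷ L) []       = sym ε⁻¹≈ε
  comb-neg (v ∷ L) (x ∷ xs) = begin
    (- x) ^ p * v + comb L (map -_ xs)  ≈⟨ +-cong (trans (*-congʳ (-^p x)) (sym (-‿distribˡ-* _ _))) (comb-neg L xs) ⟩
    - (x ^ p * v) + - comb L xs         ≈⟨ ⁻¹-∙-comm _ _ ⟩
    - (x ^ p * v + comb L xs)           ∎

  comb-zeros : ∀ L n → comb L (replicate n 0#) ≈ 0#
  comb-zeros []      n       = refl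
  comb-zeros (v ∷ L) zero    = refl
  comb-zeros (v ∷ L) (suc n) = trans (+-cong (trans (*-congʳ 0^p) (zeroˡ v)) (comb-zeros L n)) (+-identityʳ _)

  comb-++ : ∀ L₁ L₂ xs₁ xs₂ → length xs₁ ≡ length L₁ →
            comb (L₁ ++ L₂) (xs₁ ++ xs₂) ≈ comb L₁ xs₁ + comb L₂ xs₂
  comb-++ []       L₂ []        xs₂ _  = sym (+-identityˡ _)
  comb-++ (v ∷ L₁) L₂ (x ∷ xs₁) xs₂ eq =
    trans (+-congˡ (comb-++ L₁ L₂ xs₁ xs₂ (ℕP.suc-injective eq))) (sym (+-assoc _ _ _))

  comb-mapˡ : ∀ a L xs → comb (map (a *_) L) xs ≈ a * comb L xs
  comb-mapˡ a []      xs       = sym (zeroʳ a)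
  comb-mapˡ a (v ∷ L) []       = sym (zeroʳ a)
  comb-mapˡ a (v ∷ L) (x ∷ xs) =
    trans (+-cong (*-left-comm _ _ _) (comb-mapˡ a L xs)) (sym (distribˡ a _ _))

  record InSpan (L : List Carrier) (v : Carrier) : Set (c ⊔ ℓ) where
    constructor _,_
    field
      coefficients : List Carrier
      ≈comb        : v ≈ comb L coefficients

  Independent : List Carrier → Set (c ⊔ ℓ)
  Independent L = ∀ xs → length xs ≡ length L → comb L xs ≈ 0# → DoubleNegation (All (_≈ 0#) xs)

  module _ {L : List Carrier} where

    span-cong : ∀ {v w} → v ≈ w → InSpan L v → InSpan L w
    span-cong v≈w (xs , v≈) = xs , trans (sym v≈w) v≈

    span-0 : InSpan L 0#
    span-0 = [] , sym (comb-[] L)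

    span-+ : ∀ {v w} → InSpan L v → InSpan L w → InSpan L (v + w)
    span-+ (xs , v≈) (ys , w≈) = xs ⊞ ys , trans (+-cong v≈ w≈) (sym (comb-⊞ L xs ys))

    span-scale : ∀ {v} a → InSpan L v → InSpan L (a ^ p * v)
    span-scale a (xs , v≈) = map (a *_) xs , trans (*-congˡ v≈) (sym (comb-scale L a xs))

    span-neg : ∀ {v} → InSpan L v → InSpan L (- v)
    span-neg (xs , v≈) = map -_ xs , trans (-‿cong v≈) (sym (comb-neg L xs))

  span-∈ : ∀ {L v} → Any (v ≈_) L → InSpan L v
  span-∈ {w ∷ L} (here v≈w) = (1# ∷ []) , (begin
    _                  ≈⟨ v≈w ⟩
    w                  ≈⟨ trans (*-congʳ (1^n p)) (*-identityˡ w) ⟨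
    1# ^ p * w         ≈⟨ +-identityʳ _ ⟨
    1# ^ p * w + 0#    ≈⟨ +-congˡ (comb-[] L) ⟨
    1# ^ p * w + comb L [] ∎)
  span-∈ {w ∷ L} (there v∈L) with span-∈ v∈L
  ... | xs , v≈ = (0# ∷ xs) , trans v≈ (trans (sym (+-identityˡ _)) (+-congʳ (sym (trans (*-congʳ 0^p) (zeroˡ w)))))

  ∈-self : ∀ L → All (λ v → Any (v ≈_) L) L
  ∈-self []      = []
  ∈-self (v ∷ L) = here refl ∷ All.map there (∈-self L)

  span-self : ∀ L → All (InSpan L) L
  span-self L = All.map span-∈ (∈-self L)

  ⊆-++ˡ : ∀ X Y → All (InSpan (X ++ Y)) X
  ⊆-++ˡ X Y = All.map (λ v∈X → span-∈ (Any.++⁺ˡ v∈X)) (∈-self X)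

  ⊆-++ʳ : ∀ X Y → All (InSpan (X ++ Y)) Y
  ⊆-++ʳ X Y = All.map (λ v∈Y → span-∈ (Any.++⁺ʳ X v∈Y)) (∈-self Y)

  span-trans : ∀ {L M} → All (InSpan M) L → ∀ {v} → InSpan L v → InSpan M v
  span-trans {[]}    _            (xs     , v≈) = span-cong (sym v≈) span-0
  span-trans {w ∷ L} _            ([]     , v≈) = span-cong (sym v≈) span-0
  span-trans {w ∷ L} (w∈M ∷ L⊆M) (x ∷ xs , v≈) =
    span-cong (sym v≈) (span-+ (span-scale x w∈M) (span-trans L⊆M (xs , refl)))

  ⊆-trans : ∀ {L M N} → All (InSpan M) L → All (InSpan N) M → All (InSpan N) L
  ⊆-trans L⊆M M⊆N = All.map (span-trans M⊆N) L⊆M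

  independent-∷⇒≉0 : ∀ {a A} → Independent (a ∷ A) → ¬ a ≈ 0#
  independent-∷⇒≉0 {a} {A} ind a≈0 =
    ind (1# ∷ replicate (length A) 0#) (≡.cong suc (List.length-replicate (length A))) comb≈0 (λ { (1≈0 ∷ _) → 1≉0 1≈0 })
    where
    comb≈0 : 1# ^ p * a + comb A (replicate (length A) 0#) ≈ 0#
    comb≈0 = trans (+-cong (trans (*-congʳ (1^n p)) (*-identityˡ a)) (comb-zeros A _)) (trans (+-identityʳ a) a≈0)

  split-at : ∀ {a} {X : Set a} n (xs : List X) → n ≤ length xs →
             Σ (List X) λ xs₀ → Σ (List X) λ xs₁ → (xs ≡ xs₀ ++ xs₁) × (length xs₀ ≡ n)
  split-at zero    xs       _         = [] , xs , ≡.refl , ≡.refl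
  split-at (suc n) (x ∷ xs) (s≤s n≤) with split-at n xs n≤
  ... | xs₀ , xs₁ , ≡.refl , len = x ∷ xs₀ , xs₁ , ≡.refl , ≡.cong suc len

  module Exchange (w : Carrier) (B : List Carrier) where

    SplitsOff : Carrier → Set (c ⊔ ℓ)
    SplitsOff a = Σ Carrier λ t → InSpan B (a - t ^ p * w)

    Pivot : Carrier → Set (c ⊔ ℓ)
    Pivot a = Σ Carrier λ t → ¬ t ≈ 0# × InSpan B (a - t ^ p * w)

    PivotSplit : List Carrier → Set (c ⊔ ℓ)
    PivotSplit A = Σ (List Carrier) λ A₀ → Σ Carrier λ a → Σ (List Carrier) λ A₁ →
                   (A ≡ A₀ ++ a ∷ A₁) × All SplitsOff A₀ × Pivot a × All SplitsOff A₁

    -0ᵖw : ∀ {a t} → t ≈ 0# → a - t ^ p * w ≈ a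
    -0ᵖw {a} {t} t≈0 = begin
      a - t ^ p * w  ≈⟨ +-congˡ (-‿cong (trans (*-congʳ (trans (^-congˡ p t≈0) 0^p)) (zeroˡ w))) ⟩
      a - 0#         ≈⟨ +-congˡ ε⁻¹≈ε ⟩
      a + 0#         ≈⟨ +-identityʳ a ⟩
      a              ∎

    span-∷⇒splitsOff : ∀ {a} → InSpan (w ∷ B) a → SplitsOff a
    span-∷⇒splitsOff {a} ([] , a≈) = 0# , span-cong (sym (trans (-0ᵖw refl) a≈)) span-0
    span-∷⇒splitsOff {a} (x ∷ xs , a≈) = x , xs , (begin
      a - x ^ p * w                         ≈⟨ +-congʳ (trans a≈ (+-comm _ _)) ⟩
      (comb B xs + x ^ p * w) - x ^ p * w   ≈⟨ x≈x+y-y _ _ ⟨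
      comb B xs                             ∎)

    findPivot : ∀ A → All SplitsOff A → DoubleNegation (All (InSpan B) A ⊎ PivotSplit A)
    findPivot []      []                    = λ k → k (inj₁ [])
    findPivot (a ∷ A) ((t , a-tw∈B) ∷ rest) = ¬¬-excluded-middle >>= λ where
      (no t≉0)  → λ k → k (inj₂ ([] , a , A , ≡.refl , [] , (t , t≉0 , a-tw∈B) , rest))
      (yes t≈0) → findPivot A rest >>= λ where
        (inj₁ A⊆B) → λ k → k (inj₁ (span-cong (-0ᵖw t≈0) a-tw∈B ∷ A⊆B))
        (inj₂ (A₀ , b , A₁ , eq , s₀ , piv , s₁)) →
          λ k → k (inj₂ (a ∷ A₀ , b , A₁ , ≡.cong (a ∷_) eq , (t , a-tw∈B) ∷ s₀ , piv , s₁))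

    -- Subtracting ((tᵢ/t)^p)·a from every other vector, where a = t^p w + ⟨B⟩ is
    -- the pivot (t·y = 1), moves it into ⟨B⟩.
    module Eliminate (a y : Carrier) where

      eliminate : ∀ {A} → All SplitsOff A → List Carrier
      eliminate {[]}    []             = []
      eliminate {b ∷ A} ((t , _) ∷ ss) = (b - (t * y) ^ p * a) ∷ eliminate ss

      multipliers : ∀ {A} → All SplitsOff A → List Carrier
      multipliers []             = []
      multipliers ((t , _) ∷ ss) = (t * y) ∷ multipliers ss

      dot : List Carrier → List Carrier → Carrier
      dot xs       []       = 0#
      dot []       (r ∷ rs) = 0#
      dot (x ∷ xs) (r ∷ rs) = x * r + dot xs rs

      length-eliminate : ∀ {A} (ss : All SplitsOff A) → length (eliminate ss) ≡ length A
      length-eliminate []       = ≡.refl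
      length-eliminate (_ ∷ ss) = ≡.cong suc (length-eliminate ss)

      comb-eliminate : ∀ {A} (ss : All SplitsOff A) xs →
                       comb (eliminate ss) xs ≈ comb A xs - dot xs (multipliers ss) ^ p * a
      comb-eliminate []       xs = sym (trans (+-identityˡ _) (trans (-‿cong (trans (*-congʳ 0^p) (zeroˡ a))) ε⁻¹≈ε))
      comb-eliminate (_ ∷ ss) [] = sym (trans (+-identityˡ _) (trans (-‿cong (trans (*-congʳ 0^p) (zeroˡ a))) ε⁻¹≈ε))
      comb-eliminate {b ∷ A} ((t , _) ∷ ss) (x ∷ xs) = begin
        x ^ p * (b - (t * y) ^ p * a) + comb (eliminate ss) xs
          ≈⟨ +-congˡ (comb-eliminate ss xs) ⟩
        x ^ p * (b - (t * y) ^ p * a) + (comb A xs - D ^ p * a)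
          ≈⟨ +-congʳ (trans (distribˡ _ _ _) (+-congˡ (sym (-‿distribʳ-* _ _)))) ⟩
        (x ^ p * b - x ^ p * ((t * y) ^ p * a)) + (comb A xs - D ^ p * a)
          ≈⟨ +-interchange _ _ _ _ ⟩
        (x ^ p * b + comb A xs) + (- (x ^ p * ((t * y) ^ p * a)) - D ^ p * a)
          ≈⟨ +-congˡ (⁻¹-∙-comm _ _) ⟩
        (x ^ p * b + comb A xs) - (x ^ p * ((t * y) ^ p * a) + D ^ p * a)
          ≈⟨ +-congˡ (-‿cong (trans (+-congʳ (sym (*-assoc _ _ _))) (sym (distribʳ a _ _)))) ⟩
        (x ^ p * b + comb A xs) - (x ^ p * (t * y) ^ p + D ^ p) * a
          ≈⟨ +-congˡ (-‿cong (*-congʳ (sym (trans (^p-+ _ _) (+-congʳ (^p-* x (t * y))))))) ⟩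
        (x ^ p * b + comb A xs) - (x * (t * y) + D) ^ p * a
          ∎
        where D = dot xs (multipliers ss)

      eliminate⊆B : ∀ t → t * y ≈ 1# → InSpan B (a - t ^ p * w) →
                    ∀ {A} (ss : All SplitsOff A) → All (InSpan B) (eliminate ss)
      eliminate⊆B t ty≈1 a∈ []                     = []
      eliminate⊆B t ty≈1 a∈ {b ∷ A} ((tᵢ , b∈) ∷ ss) =
        span-cong b-eq (span-+ b∈ (span-neg (span-scale (tᵢ * y) a∈))) ∷ eliminate⊆B t ty≈1 a∈ ss
        where
        u = (tᵢ * y) ^ p
        ut≈tᵢ : u * t ^ p ≈ tᵢ ^ p
        ut≈tᵢ = begin
          u * t ^ p          ≈⟨ ^p-* _ _ ⟨
          (tᵢ * y * t) ^ p   ≈⟨ ^-congˡ p (trans (*-assoc _ _ _) (trans (*-congˡ (trans (*-comm y t) ty≈1)) (*-identityʳ tᵢ))) ⟩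
          tᵢ ^ p             ∎
        b-eq : (b - tᵢ ^ p * w) - u * (a - t ^ p * w) ≈ b - u * a
        b-eq = begin
          (b - tᵢ ^ p * w) - u * (a - t ^ p * w)            ≈⟨ +-congˡ (-‿cong (trans (distribˡ u a _) (+-congˡ (sym (-‿distribʳ-* u _))))) ⟩
          (b - tᵢ ^ p * w) - (u * a - u * (t ^ p * w))      ≈⟨ +-congˡ (sym (⁻¹-∙-comm _ _)) ⟩
          (b - tᵢ ^ p * w) + (- (u * a) - - (u * (t ^ p * w))) ≈⟨ +-congˡ (+-congˡ (⁻¹-involutive _)) ⟩
          (b - tᵢ ^ p * w) + (- (u * a) + u * (t ^ p * w))  ≈⟨ +-congˡ (+-congˡ (trans (sym (*-assoc _ _ _)) (*-congʳ ut≈tᵢ))) ⟩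
          (b - tᵢ ^ p * w) + (- (u * a) + tᵢ ^ p * w)       ≈⟨ +-interchange _ _ _ _ ⟩
          (b - u * a) + (- (tᵢ ^ p * w) + tᵢ ^ p * w)       ≈⟨ +-congˡ (-‿inverseˡ _) ⟩
          (b - u * a) + 0#                                  ≈⟨ +-identityʳ _ ⟩
          b - u * a                                         ∎

      module _ {A₀ A₁} (s₀ : All SplitsOff A₀) (s₁ : All SplitsOff A₁) where

        A′ = eliminate s₀ ++ eliminate s₁

        length-A′ : length A′ ≡ length A₀ ℕ.+ length A₁
        length-A′ = ≡.trans (List.length-++ (eliminate s₀)) (≡.cong₂ ℕ._+_ (length-eliminate s₀) (length-eliminate s₁))

        lift : List Carrier → List Carrier → List Carrier
        lift xs₀ xs₁ = xs₀ ++ (- (dot xs₀ (multipliers s₀) + dot xs₁ (multipliers s₁))) ∷ xs₁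

        comb-lift : ∀ xs₀ xs₁ → length xs₀ ≡ length A₀ → comb (A₀ ++ a ∷ A₁) (lift xs₀ xs₁) ≈ comb A′ (xs₀ ++ xs₁)
        comb-lift xs₀ xs₁ len₀ = begin
          comb (A₀ ++ a ∷ A₁) (lift xs₀ xs₁)
            ≈⟨ comb-++ A₀ (a ∷ A₁) xs₀ _ len₀ ⟩
          comb A₀ xs₀ + ((- (d₀ + d₁)) ^ p * a + comb A₁ xs₁)
            ≈⟨ +-congˡ (trans (+-congʳ pivot-term) (trans (+-assoc _ _ _) (+-comm _ _))) ⟩
          comb A₀ xs₀ + ((- (d₁ ^ p * a) + comb A₁ xs₁) - d₀ ^ p * a)
            ≈⟨ +-congˡ (trans (+-comm _ _) (+-congˡ (+-comm _ _))) ⟩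
          comb A₀ xs₀ + (- (d₀ ^ p * a) + (comb A₁ xs₁ - d₁ ^ p * a))
            ≈⟨ +-assoc _ _ _ ⟨
          (comb A₀ xs₀ - d₀ ^ p * a) + (comb A₁ xs₁ - d₁ ^ p * a)
            ≈⟨ +-cong (comb-eliminate s₀ xs₀) (comb-eliminate s₁ xs₁) ⟨
          comb (eliminate s₀) xs₀ + comb (eliminate s₁) xs₁
            ≈⟨ comb-++ (eliminate s₀) (eliminate s₁) xs₀ xs₁ (≡.trans len₀ (≡.sym (length-eliminate s₀))) ⟨
          comb A′ (xs₀ ++ xs₁)
            ∎
          where
          d₀ = dot xs₀ (multipliers s₀)
          d₁ = dot xs₁ (multipliers s₁)
          pivot-term : (- (d₀ + d₁)) ^ p * a ≈ - (d₀ ^ p * a) - d₁ ^ p * a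
          pivot-term = begin
            (- (d₀ + d₁)) ^ p * a        ≈⟨ *-congʳ (trans (-^p _) (-‿cong (^p-+ d₀ d₁))) ⟩
            - (d₀ ^ p + d₁ ^ p) * a      ≈⟨ -‿distribˡ-* _ a ⟨
            - ((d₀ ^ p + d₁ ^ p) * a)    ≈⟨ -‿cong (distribʳ a _ _) ⟩
            - (d₀ ^ p * a + d₁ ^ p * a)  ≈⟨ ⁻¹-∙-comm _ _ ⟨
            - (d₀ ^ p * a) - d₁ ^ p * a  ∎

        eliminated-independent : Independent (A₀ ++ a ∷ A₁) → Independent A′
        eliminated-independent ind xs len comb≈0
          with split-at (length A₀) xs (≡.subst (length A₀ ≤_) (≡.sym (≡.trans len length-A′)) (ℕP.m≤m+n _ _))
        ... | xs₀ , xs₁ , ≡.refl , len₀ =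
          ¬¬-map drop-pivot (ind (lift xs₀ xs₁) length-lift (trans (comb-lift xs₀ xs₁ len₀) comb≈0))
          where
          len₁ : length xs₁ ≡ length A₁
          len₁ = ℕP.+-cancelˡ-≡ (length A₀) _ _
                   (≡.trans (≡.cong (ℕ._+ length xs₁) (≡.sym len₀)) (≡.trans (≡.sym (List.length-++ xs₀)) (≡.trans len length-A′)))
          length-lift : length (lift xs₀ xs₁) ≡ length (A₀ ++ a ∷ A₁)
          length-lift = ≡.trans (List.length-++ xs₀)
                          (≡.trans (≡.cong₂ (λ m n → m ℕ.+ suc n) len₀ len₁) (≡.sym (List.length-++ A₀)))
          drop-pivot : All (_≈ 0#) (lift xs₀ xs₁) → All (_≈ 0#) (xs₀ ++ xs₁)
          drop-pivot z with All.++⁻ xs₀ z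
          ... | z₀ , (_ ∷ z₁) = All.++⁺ z₀ z₁

  steinitz : ∀ {B A} → Independent A → All (InSpan B) A → DoubleNegation (length A ≤ length B)
  steinitz {[]}    {[]}    _   _                 = λ k → k z≤n
  steinitz {[]}    {a ∷ A} ind ((xs , a≈0) ∷ _) = λ _ → independent-∷⇒≉0 ind a≈0
  steinitz {w ∷ B} {A}     ind A⊆wB =
    findPivot A (All.map span-∷⇒splitsOff A⊆wB) >>= λ where
      (inj₁ A⊆B) → ¬¬-map ℕP.m≤n⇒m≤1+n (steinitz ind A⊆B)
      (inj₂ (A₀ , a , A₁ , ≡.refl , s₀ , (t , t≉0 , a∈) , s₁)) → pivot-step s₀ t≉0 a∈ s₁ ind
    where
    open Exchange w B
    pivot-step : ∀ {A₀ a A₁ t} (s₀ : All SplitsOff A₀) → ¬ t ≈ 0# → InSpan B (a - t ^ p * w) →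
                 (s₁ : All SplitsOff A₁) → Independent (A₀ ++ a ∷ A₁) →
                 DoubleNegation (length (A₀ ++ a ∷ A₁) ≤ suc (length B))
    pivot-step {A₀} {a} {A₁} {t} s₀ t≉0 a∈ s₁ ind with inverse t t≉0
    ... | y , ty≈1 = ¬¬-map length-bound
                       (steinitz (eliminated-independent s₀ s₁ ind) (All.++⁺ (eliminate⊆B t ty≈1 a∈ s₀) (eliminate⊆B t ty≈1 a∈ s₁)))
      where
      open Eliminate a y
      length-bound : length (A′ s₀ s₁) ≤ length B → length (A₀ ++ a ∷ A₁) ≤ suc (length B)
      length-bound le rewrite List.length-++ A₀ {a ∷ A₁} | ℕP.+-suc (length A₀) (length A₁) | ≡.sym (length-A′ s₀ s₁) = s≤s le

module DualNumbers {c ℓ} (R : CommutativeRing c ℓ) where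
  open CommutativeRing R
  open import Algebra.Solver.Ring.NaturalCoefficients.Default commutativeSemiring

  D : Set c
  D = Carrier × Carrier

  _≈D_ : D → D → Set ℓ
  (a , b) ≈D (c , d) = (a ≈ c) × (b ≈ d)

  _+D_ _*D_ : D → D → D
  (a , b) +D (c , d) = (a + c , b + d)
  (a , b) *D (c , d) = (a * c , a * d + b * c)

  -D_ : D → D
  -D (a , b) = (- a , - b)

  0D 1D : D
  0D = (0# , 0#)
  1D = (1# , 0#)

  private
    ε-assoc : ∀ a b c d e f → (a * c) * f + (a * d + b * c) * e ≈ a * (c * f + d * e) + b * (c * e)
    ε-assoc = solve 6 (λ a b c d e f → (a :* c) :* f :+ (a :* d :+ b :* c) :* e := a :* (c :* f :+ d :* e) :+ b :* (c :* e)) refl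
    ε-identityˡ : ∀ c d → 1# * d + 0# * c ≈ d
    ε-identityˡ = solve 2 (λ c d → con 1 :* d :+ con 0 :* c := d) refl
    ε-identityʳ : ∀ a b → a * 0# + b * 1# ≈ b
    ε-identityʳ = solve 2 (λ a b → a :* con 0 :+ b :* con 1 := b) refl
    ε-distribˡ : ∀ a b c d e f → a * (d + f) + b * (c + e) ≈ (a * d + b * c) + (a * f + b * e)
    ε-distribˡ = solve 6 (λ a b c d e f → a :* (d :+ f) :+ b :* (c :+ e) := (a :* d :+ b :* c) :+ (a :* f :+ b :* e)) refl
    ε-distribʳ : ∀ a b c d e f → (c + e) * b + (d + f) * a ≈ (c * b + d * a) + (e * b + f * a)
    ε-distribʳ = solve 6 (λ a b c d e f → (c :+ e) :* b :+ (d :+ f) :* a := (c :* b :+ d :* a) :+ (e :* b :+ f :* a)) refl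
    ε-comm : ∀ a b c d → a * d + b * c ≈ c * b + d * a
    ε-comm = solve 4 (λ a b c d → a :* d :+ b :* c := c :* b :+ d :* a) refl

  dual-isCommutativeRing : IsCommutativeRing _≈D_ _+D_ _*D_ -D_ 0D 1D
  dual-isCommutativeRing = record
    { isRing = record
      { +-isAbelianGroup = record
        { isGroup = record
          { isMonoid = record
            { isSemigroup = record
              { isMagma = record
                { isEquivalence = record
                  { refl  = refl , refl
                  ; sym   = λ { (x , y) → sym x , sym y }
                  ; trans = λ { (x , y) (u , v) → trans x u , trans y v } }
                ; ∙-cong = λ { (x , y) (u , v) → +-cong x u , +-cong y v } }
              ; assoc = λ { (a , b) (c , d) (e , f) → +-assoc a c e , +-assoc b d f } }
            ; identity = (λ { (a , b) → +-identityˡ a , +-identityˡ b })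
                       , (λ { (a , b) → +-identityʳ a , +-identityʳ b }) }
          ; inverse = (λ { (a , b) → -‿inverseˡ a , -‿inverseˡ b })
                    , (λ { (a , b) → -‿inverseʳ a , -‿inverseʳ b })
          ; ⁻¹-cong = λ { (x , y) → -‿cong x , -‿cong y } }
        ; comm = λ { (a , b) (c , d) → +-comm a c , +-comm b d } }
      ; *-cong = λ { (x , y) (u , v) → *-cong x u , +-cong (*-cong x v) (*-cong y u) }
      ; *-assoc = λ { (a , b) (c , d) (e , f) → *-assoc a c e , ε-assoc a b c d e f }
      ; *-identity = (λ { (c , d) → *-identityˡ c , ε-identityˡ c d })
                   , (λ { (a , b) → *-identityʳ a , ε-identityʳ a b })
      ; distrib = (λ { (a , b) (c , d) (e , f) → distribˡ a c e , ε-distribˡ a b c d e f })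
                , (λ { (a , b) (c , d) (e , f) → distribʳ a c e , ε-distribʳ a b c d e f }) }
    ; *-comm = λ { (a , b) (c , d) → *-comm a c , ε-comm a b c d } }

  dualNumbers : CommutativeRing c ℓ
  dualNumbers = record { isCommutativeRing = dual-isCommutativeRing }

  open import Algebra.Properties.Semiring.Exp semiring using (_^_)
  open import Algebra.Properties.Monoid.Mult +-monoid renaming (_×_ to _×ₙ_)
  open import Algebra.Properties.Semiring.Exp (CommutativeRing.semiring dualNumbers)
    using () renaming (_^_ to _^D_)
  open import Relation.Binary.Reasoning.Setoid setoid

  x+ε^ : ∀ x j → ((x , 1#) ^D suc j) ≈D (x ^ suc j , suc j ×ₙ x ^ j)
  x+ε^ x zero    = refl , trans (+-cong (zeroʳ x) (*-identityʳ 1#)) (trans (+-identityˡ 1#) (sym (+-identityʳ 1#)))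
  x+ε^ x (suc j) with x+ε^ x j
  ... | fst≈ , snd≈ = *-congˡ fst≈ , (begin
    x * proj₂ ((x , 1#) ^D suc j) + 1# * proj₁ ((x , 1#) ^D suc j)  ≈⟨ +-cong (*-congˡ snd≈) (*-congˡ fst≈) ⟩
    x * (suc j ×ₙ x ^ j) + 1# * x ^ suc j                            ≈⟨ +-cong (×-comm-* (suc j) x _) (*-identityˡ _) ⟩
    suc j ×ₙ (x * x ^ j) + x ^ suc j                                 ≈⟨ +-comm _ _ ⟩
    suc (suc j) ×ₙ x ^ suc j                                         ∎)
    where open import Algebra.Properties.Semiring.Mult semiring using (×-comm-*)

module Algebras {c ℓ} (E : Field c ℓ) where
  private module F = Field E
  open PaddedSum F._+_ public

  record EAlgebra : Set (lsuc (c ⊔ ℓ)) where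
    field
      R : CommutativeRing c ℓ
    open CommutativeRing R
    field
      ι      : F.Carrier → Carrier
      ι-cong : ∀ {x y} → x F.≈ y → ι x ≈ ι y
      ι-+    : ∀ x y → ι (x F.+ y) ≈ ι x + ι y
      ι-*    : ∀ x y → ι (x F.* y) ≈ ι x * ι y
      ι-0    : ι F.0# ≈ 0#
      ι-1    : ι F.1# ≈ 1#

  self : EAlgebra
  self = record { R = F.commutativeRing ; ι = λ x → x ; ι-cong = λ e → e
                ; ι-+ = λ _ _ → F.refl ; ι-* = λ _ _ → F.refl ; ι-0 = F.refl ; ι-1 = F.refl }

  dual : EAlgebra → EAlgebra
  dual A = record
    { R      = DualNumbers.dualNumbers R
    ; ι      = λ x → (ι x , 0#)
    ; ι-cong = λ e → ι-cong e , refl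
    ; ι-+    = λ x y → ι-+ x y , sym (+-identityˡ 0#)
    ; ι-*    = λ x y → ι-* x y , sym (trans (+-cong (zeroʳ _) (zeroˡ _)) (+-identityˡ 0#))
    ; ι-0    = ι-0 , refl
    ; ι-1    = ι-1 , refl }
    where open EAlgebra A
          open CommutativeRing R

  -- tower n = E[ε₁,…,εₙ]/(ε₁²,…,εₙ²), with ε n = ε₁ + ⋯ + εₙ
  tower : ℕ → EAlgebra
  tower zero    = self
  tower (suc n) = dual (tower n)

  ε : ∀ n → CommutativeRing.Carrier (EAlgebra.R (tower n))
  ε zero    = F.0#
  ε (suc n) = (ε n , CommutativeRing.1# (EAlgebra.R (tower n)))

  module Homomorphism (A : EAlgebra) where
    open EAlgebra A
    open CommutativeRing R
    open import Algebra.Properties.Semiring.Exp semiring using (_^_)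
    open import Algebra.Properties.Monoid.Mult +-monoid using (×-congʳ) renaming (_×_ to _×ₙ_)
    open import Algebra.Properties.Semiring.Exp F.semiring using () renaming (_^_ to _^E_)
    open import Algebra.Properties.Monoid.Mult F.+-monoid using () renaming (_×_ to _×E_)

    ι-neg : ∀ x → ι (F.- x) ≈ - ι x
    ι-neg x = RingLemmas.inverseˡ-unique R _ _ (trans (sym (ι-+ (F.- x) x)) (trans (ι-cong (F.-‿inverseˡ x)) ι-0))

    ι-^ : ∀ x k → ι (x ^E k) ≈ ι x ^ k
    ι-^ x zero    = ι-1
    ι-^ x (suc k) = trans (ι-* x _) (*-congˡ (ι-^ x k))

    ι-× : ∀ k x → ι (k ×E x) ≈ k ×ₙ ι x
    ι-× zero    x = ι-0
    ι-× (suc k) x = trans (ι-+ x _) (+-congˡ (ι-× k x))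

    ι-char : ∀ {n} → n ×E F.1# F.≈ F.0# → n ×ₙ 1# ≈ 0#
    ι-char {n} n≈0 = trans (sym (×-congʳ n ι-1)) (trans (sym (ι-× n F.1#)) (trans (ι-cong n≈0) ι-0))

  -- coefficient lists start with the constant term
  module Horner (A : EAlgebra) (u : CommutativeRing.Carrier (EAlgebra.R A)) where
    open EAlgebra A
    open CommutativeRing R
    open import Algebra.Properties.Semiring.Exp semiring using (_^_)
    open RingLemmas R using (+-interchange; *-left-comm; ⁻¹-∙-comm; ε⁻¹≈ε; -‿distribʳ-*)
    open Homomorphism A using (ι-neg)
    open import Relation.Binary.Reasoning.Setoid setoid

    eval : List F.Carrier → Carrier
    eval []       = 0#
    eval (x ∷ xs) = ι x + u * eval xs

    eval-⊞ : ∀ xs ys → eval (xs ⊞ ys) ≈ eval xs + eval ys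
    eval-⊞ []       ys       = sym (+-identityˡ _)
    eval-⊞ (x ∷ xs) []       = sym (+-identityʳ _)
    eval-⊞ (x ∷ xs) (y ∷ ys) = begin
      ι (x F.+ y) + u * eval (xs ⊞ ys)         ≈⟨ +-cong (ι-+ x y) (*-congˡ (eval-⊞ xs ys)) ⟩
      (ι x + ι y) + u * (eval xs + eval ys)    ≈⟨ +-congˡ (distribˡ u _ _) ⟩
      (ι x + ι y) + (u * eval xs + u * eval ys) ≈⟨ +-interchange _ _ _ _ ⟩
      (ι x + u * eval xs) + (ι y + u * eval ys) ∎

    eval-scale : ∀ a xs → eval (map (a F.*_) xs) ≈ ι a * eval xs
    eval-scale a []       = sym (zeroʳ _)
    eval-scale a (x ∷ xs) = begin
      ι (a F.* x) + u * eval (map (a F.*_) xs)  ≈⟨ +-cong (ι-* a x) (trans (*-congˡ (eval-scale a xs)) (*-left-comm _ _ _)) ⟩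
      ι a * ι x + ι a * (u * eval xs)           ≈⟨ distribˡ _ _ _ ⟨
      ι a * (ι x + u * eval xs)                 ∎

    eval-neg : ∀ xs → eval (map F.-_ xs) ≈ - eval xs
    eval-neg []       = sym ε⁻¹≈ε
    eval-neg (x ∷ xs) = begin
      ι (F.- x) + u * eval (map F.-_ xs)  ≈⟨ +-cong (ι-neg x) (trans (*-congˡ (eval-neg xs)) (sym (-‿distribʳ-* _ _))) ⟩
      - ι x + - (u * eval xs)             ≈⟨ ⁻¹-∙-comm _ _ ⟩
      - (ι x + u * eval xs)               ∎

    eval-0∷ : ∀ xs → eval (F.0# ∷ xs) ≈ u * eval xs
    eval-0∷ xs = trans (+-congʳ ι-0) (+-identityˡ _)

    eval-[_] : ∀ x → eval (x ∷ []) ≈ ι x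
    eval-[ x ] = trans (+-congˡ (zeroʳ u)) (+-identityʳ _)

    eval-++ : ∀ xs ys → eval (xs ++ ys) ≈ eval xs + u ^ length xs * eval ys
    eval-++ []       ys = sym (trans (+-identityˡ _) (*-identityˡ _))
    eval-++ (x ∷ xs) ys = begin
      ι x + u * eval (xs ++ ys)                        ≈⟨ +-congˡ (*-congˡ (eval-++ xs ys)) ⟩
      ι x + u * (eval xs + u ^ length xs * eval ys)    ≈⟨ +-congˡ (distribˡ _ _ _) ⟩
      ι x + (u * eval xs + u * (u ^ length xs * eval ys)) ≈⟨ +-assoc _ _ _ ⟨
      (ι x + u * eval xs) + u * (u ^ length xs * eval ys) ≈⟨ +-congˡ (*-assoc _ _ _) ⟨
      (ι x + u * eval xs) + u ^ suc (length xs) * eval ys ∎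

    eval-monic : ∀ xs → eval (xs ++ F.1# ∷ []) ≈ eval xs + u ^ length xs
    eval-monic xs = trans (eval-++ xs _) (+-congˡ (trans (*-congˡ (trans eval-[ F.1# ] ι-1)) (*-identityʳ _)))

    eval-zeros : ∀ k → eval (replicate k F.0#) ≈ 0#
    eval-zeros zero    = refl
    eval-zeros (suc k) = trans (eval-0∷ (replicate k F.0#)) (trans (*-congˡ (eval-zeros k)) (zeroʳ u))

    eval-monomial : ∀ k x → eval (replicate k F.0# ++ x ∷ []) ≈ ι x * u ^ k
    eval-monomial k x = begin
      eval (replicate k F.0# ++ x ∷ [])                                     ≈⟨ eval-++ (replicate k F.0#) _ ⟩
      eval (replicate k F.0#) + u ^ length (replicate k F.0#) * eval (x ∷ []) ≈⟨ +-cong (eval-zeros k) (*-congʳ (reflexive (≡.cong (u ^_) (List.length-replicate k)))) ⟩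
      0# + u ^ k * eval (x ∷ [])                                            ≈⟨ trans (+-identityˡ _) (trans (*-congˡ eval-[ x ]) (*-comm _ _)) ⟩
      ι x * u ^ k                                                           ∎

  -- In tower n the element ε n behaves like the generator of E[s]/(s^(n+1)):
  -- ε n ^ (n + 1) = 0, while ε n ^ n = n! ε₁⋯εₙ is not killed by nonzero scalars (n < p).
  module TowerNilpotency {p} (pp : Prime p) (char : Forms.HasChar E p) where
    open Eᵖ-Linear E pp char using (×1≉0)
    module T (n : ℕ) = CommutativeRing (EAlgebra.R (tower n))
    module T^ (n : ℕ) = Algebra.Properties.Semiring.Exp (T.semiring n)
    open import Algebra.Properties.Monoid.Mult F.+-monoid using () renaming (_×_ to _×E_)
    import Algebra.Properties.Monoid.Mult as Mult
    import Algebra.Properties.Semiring.Mult as SemiringMult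

    ε-nilpotent : ∀ n → T._≈_ n (T^._^_ n (ε n) (suc n)) (T.0# n)
    ε-nilpotent zero    = F.zeroˡ _
    ε-nilpotent (suc n) with DualNumbers.x+ε^ (EAlgebra.R (tower n)) (ε n) (suc n)
    ... | fst≈ , snd≈ =
        T.trans n fst≈ (T.trans n (T.*-congˡ n (ε-nilpotent n)) (T.zeroʳ n _))
      , T.trans n snd≈ (T.trans n (Mult.×-congʳ (T.+-monoid n) (suc (suc n)) (ε-nilpotent n))
                                  (Frobenius.×-zero (EAlgebra.R (tower n)) (suc (suc n))))

    ε^n-torsionFree : ∀ n → n < p → ∀ x →
      T._≈_ n (T._*_ n (EAlgebra.ι (tower n) x) (T^._^_ n (ε n) n)) (T.0# n) → x F.≈ F.0#
    ε^n-torsionFree zero    _    x x≈0       = F.trans (F.sym (F.*-identityʳ x)) x≈0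
    ε^n-torsionFree (suc n) n<p x (_ , ε≈0) with DualNumbers.x+ε^ (EAlgebra.R (tower n)) (ε n) n
    ... | _ , snd≈ = cancel (ε^n-torsionFree n (ℕP.<-trans (ℕP.n<1+n n) n<p) (suc n ×E x) [n+1]x·εⁿ≈0)
      where
      open T n using (_≈_; _*_; 0#; trans; sym; *-congˡ; *-congʳ; +-congˡ; zeroˡ; +-identityʳ)
      open SemiringMult (T.semiring n) using (×-assoc-*; ×-comm-*)
      ιx = EAlgebra.ι (tower n) x
      [n+1]x·εⁿ≈0 : EAlgebra.ι (tower n) (suc n ×E x) * T^._^_ n (ε n) n ≈ 0#
      [n+1]x·εⁿ≈0 =
        trans (*-congʳ (Homomorphism.ι-× (tower n) (suc n) x))
        (trans (×-assoc-* (suc n) ιx _)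
        (trans (sym (×-comm-* (suc n) ιx _))
        (trans (*-congˡ (sym snd≈))
        (trans (sym (trans (+-congˡ (zeroˡ _)) (+-identityʳ _))) ε≈0))))
      cancel : suc n ×E x F.≈ F.0# → x F.≈ F.0#
      cancel [n+1]x≈0 with F.inverse (suc n ×E F.1#) (×1≉0 (suc n) (s≤s z≤n) n<p)
      ... | y , ny≈1 = begin
        x                            ≈⟨ F.*-identityˡ x ⟨
        F.1# F.* x                   ≈⟨ F.*-congʳ (F.trans (F.sym ny≈1) (F.*-comm _ y)) ⟩
        (y F.* (suc n ×E F.1#)) F.* x ≈⟨ F.*-assoc _ _ _ ⟩
        y F.* ((suc n ×E F.1#) F.* x) ≈⟨ F.*-congˡ (SemiringMult.×-assoc-* F.semiring (suc n) F.1# x) ⟩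
        y F.* (suc n ×E (F.1# F.* x)) ≈⟨ F.*-congˡ (Mult.×-congʳ F.+-monoid (suc n) (F.*-identityˡ x)) ⟩
        y F.* (suc n ×E x)           ≈⟨ F.*-congˡ [n+1]x≈0 ⟩
        y F.* F.0#                   ≈⟨ F.zeroʳ y ⟩
        F.0#                         ∎
        where open import Relation.Binary.Reasoning.Setoid F.setoid

module Derivative {c ℓ} (E : Field c ℓ) where
  private module F = Field E
  open Algebras E
  open import Algebra.Properties.Monoid.Mult F.+-monoid using () renaming (_×_ to _×E_)

  derivative : List F.Carrier → List F.Carrier
  derivative []          = []
  derivative (x ∷ [])    = []
  derivative (x ∷ y ∷ g) = (y ∷ g) ⊞ (F.0# ∷ derivative (y ∷ g))

  private
    ⊞-snoc : ∀ a b x y → length a ≡ length b → (a ++ x ∷ []) ⊞ (b ++ y ∷ []) ≡ (a ⊞ b) ++ (x F.+ y) ∷ []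
    ⊞-snoc []       []       x y _  = ≡.refl
    ⊞-snoc (a ∷ as) (b ∷ bs) x y eq = ≡.cong ((a F.+ b) ∷_) (⊞-snoc as bs x y (ℕP.suc-injective eq))

    length-⊞ : ∀ a b → length a ≡ length b → length (a ⊞ b) ≡ length a
    length-⊞ []       []       _  = ≡.refl
    length-⊞ (a ∷ as) (b ∷ bs) eq = ≡.cong suc (length-⊞ as bs (ℕP.suc-injective eq))

  derivative-leading : ∀ c₀ l x → Σ (List F.Carrier) λ l′ →
    (derivative ((c₀ ∷ l) ++ x ∷ []) ≡ l′ ++ (suc (length l) ×E x) ∷ []) × (length l′ ≡ length l)
  derivative-leading c₀ []       x = [] , ≡.refl , ≡.refl
  derivative-leading c₀ (c₁ ∷ l) x with derivative-leading c₁ l x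
  ... | l′ , eq , len = (c₁ ∷ l) ⊞ (F.0# ∷ l′)
      , ≡.trans (≡.cong (λ d → ((c₁ ∷ l) ++ x ∷ []) ⊞ (F.0# ∷ d)) eq)
                (⊞-snoc (c₁ ∷ l) (F.0# ∷ l′) x _ (≡.cong suc (≡.sym len)))
      , length-⊞ (c₁ ∷ l) (F.0# ∷ l′) (≡.cong suc (≡.sym len))

  module Closed (K : F.Carrier → Set (c ⊔ ℓ)) (K0 : K F.0#) (K+ : ∀ {x y} → K x → K y → K (x F.+ y)) where

    ⊞-closed : ∀ {a b} → All K a → All K b → All K (a ⊞ b)
    ⊞-closed []         kb         = kb
    ⊞-closed (ka ∷ kas) []         = ka ∷ kas
    ⊞-closed (ka ∷ kas) (kb ∷ kbs) = K+ ka kb ∷ ⊞-closed kas kbs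

    derivative-closed : ∀ {l} → All K l → All K (derivative l)
    derivative-closed []             = []
    derivative-closed (_ ∷ [])       = []
    derivative-closed (_ ∷ k₁ ∷ ks)  = ⊞-closed (k₁ ∷ ks) (K0 ∷ derivative-closed (k₁ ∷ ks))

  ⊞-length≤ : ∀ {n} xs ys → length xs ≤ n → length ys ≤ n → length (xs ⊞ ys) ≤ n
  ⊞-length≤ []       ys       _          le         = le
  ⊞-length≤ (x ∷ xs) []       le         _          = le
  ⊞-length≤ (x ∷ xs) (y ∷ ys) (s≤s le₁) (s≤s le₂) = s≤s (⊞-length≤ xs ys le₁ le₂)

  module Expansion (A : EAlgebra) (α : F.Carrier) (s : CommutativeRing.Carrier (EAlgebra.R A)) where
    open EAlgebra A
    open CommutativeRing R
    open import Algebra.Properties.Semiring.Exp semiring using (_^_)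
    open import Relation.Binary.Reasoning.Setoid setoid
    open import Algebra.Solver.Ring.NaturalCoefficients.Default commutativeSemiring

    u : Carrier
    u = ι α + s

    module Eu = Horner A u
    module Es = Horner A s
    module Eα = Horner self α

    private
      taylor-step : ∀ x a s A A′ B → x + (a + s) * (A + s * (A′ + s * B)) ≈ (x + a * A) + s * ((A + a * A′) + s * ((a * B + A′) + s * B))
      taylor-step = solve 6 (λ x a s A A′ B → x :+ (a :+ s) :* (A :+ s :* (A′ :+ s :* B)) := (x :+ a :* A) :+ s :* ((A :+ a :* A′) :+ s :* ((a :* B :+ A′) :+ s :* B))) refl
      shift-step : ∀ g T S a s → g + (a + s) * (T + S) ≈ (g + (a * T + (s * T + a * S))) + s * S
      shift-step = solve 5 (λ g T S a s → g :+ (a :+ s) :* (T :+ S) := (g :+ (a :* T :+ (s :* T :+ a :* S))) :+ s :* S) refl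
      horner-step : ∀ g u X Y → (g + u * X) + u * Y ≈ g + u * (X + Y)
      horner-step = solve 4 (λ g u X Y → (g :+ u :* X) :+ u :* Y := g :+ u :* (X :+ Y)) refl

    taylor : ∀ f → Σ Carrier λ B → Eu.eval f ≈ ι (Eα.eval f) + s * (ι (Eα.eval (derivative f)) + s * B)
    taylor []          = 0# , sym (trans (+-cong ι-0 (trans (*-congˡ (trans (+-cong ι-0 (zeroʳ s)) (+-identityʳ 0#))) (zeroʳ s))) (+-identityʳ 0#))
    taylor (x ∷ [])    = 0# , (begin
      ι x + u * 0#                             ≈⟨ +-cong (ι-cong (F.sym (F.trans (F.+-congˡ (F.zeroʳ α)) (F.+-identityʳ x)))) (zeroʳ u) ⟩
      ι (x F.+ α F.* F.0#) + 0#                ≈⟨ +-congˡ (sym (trans (*-congˡ (trans (+-cong ι-0 (zeroʳ s)) (+-identityʳ 0#))) (zeroʳ s))) ⟩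
      ι (x F.+ α F.* F.0#) + s * (ι F.0# + s * 0#) ∎)
    taylor (x ∷ y ∷ g) with taylor (y ∷ g)
    ... | B , eq = (ι α * B + ι G′) + s * B , (begin
      ι x + u * Eu.eval (y ∷ g)                                       ≈⟨ +-congˡ (*-congˡ eq) ⟩
      ι x + (ι α + s) * (ι G + s * (ι G′ + s * B))                    ≈⟨ taylor-step _ _ _ _ _ _ ⟩
      (ι x + ι α * ι G) + s * ((ι G + ι α * ι G′) + s * ((ι α * B + ι G′) + s * B))
        ≈⟨ +-cong (sym (trans (ι-+ x _) (+-congˡ (ι-* α G)))) (*-congˡ (+-congʳ (sym ι-derivative))) ⟩
      ι (x F.+ α F.* G) + s * (ι (Eα.eval (derivative (x ∷ y ∷ g))) + s * ((ι α * B + ι G′) + s * B)) ∎)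
      where
      G  = Eα.eval (y ∷ g)
      G′ = Eα.eval (derivative (y ∷ g))
      ι-derivative : ι (Eα.eval ((y ∷ g) ⊞ (F.0# ∷ derivative (y ∷ g)))) ≈ ι G + ι α * ι G′
      ι-derivative = trans (ι-cong (F.trans (Eα.eval-⊞ (y ∷ g) (F.0# ∷ derivative (y ∷ g))) (F.+-congˡ (Eα.eval-0∷ (derivative (y ∷ g))))))
                           (trans (ι-+ _ _) (+-congˡ (ι-* α G′)))

    monic-shift : ∀ g → Σ (List F.Carrier) λ t → (length t ≤ length g) × (Eu.eval g + u ^ length g ≈ Es.eval t + s ^ length g)
    monic-shift []       = [] , z≤n , refl
    monic-shift (g₀ ∷ g) with monic-shift g
    ... | t′ , le , eq = t , length-t , (begin
      (ι g₀ + u * Eu.eval g) + u * u ^ k         ≈⟨ horner-step _ _ _ _ ⟩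
      ι g₀ + u * (Eu.eval g + u ^ k)             ≈⟨ +-congˡ (*-congˡ eq) ⟩
      ι g₀ + (ι α + s) * (T + S)                 ≈⟨ shift-step _ _ _ _ _ ⟩
      (ι g₀ + (ι α * T + (s * T + ι α * S))) + s * S ≈⟨ +-congʳ (sym eval-t) ⟩
      Es.eval t + s ^ suc k                      ∎)
      where
      k = length g
      T = Es.eval t′
      S = s ^ k
      L₃ = replicate k F.0# ++ α ∷ []
      L₂ = (F.0# ∷ t′) ⊞ L₃
      L₁ = map (α F.*_) t′ ⊞ L₂
      t = (g₀ ∷ []) ⊞ L₁
      length-t : length t ≤ suc k
      length-t = ⊞-length≤ (g₀ ∷ []) L₁ (s≤s z≤n)
        (⊞-length≤ (map (α F.*_) t′) L₂ (ℕP.≤-trans (ℕP.≤-reflexive (List.length-map _ t′)) (ℕP.m≤n⇒m≤1+n le))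
          (⊞-length≤ (F.0# ∷ t′) L₃ (s≤s le)
            (ℕP.≤-reflexive (≡.trans (List.length-++ (replicate k F.0#))
              (≡.trans (≡.cong (ℕ._+ 1) (List.length-replicate k)) (ℕP.+-comm k 1))))))
      eval-t : Es.eval t ≈ ι g₀ + (ι α * T + (s * T + ι α * S))
      eval-t = begin
        Es.eval t                                   ≈⟨ Es.eval-⊞ (g₀ ∷ []) L₁ ⟩
        Es.eval (g₀ ∷ []) + Es.eval L₁              ≈⟨ +-cong Es.eval-[ g₀ ] (Es.eval-⊞ (map (α F.*_) t′) L₂) ⟩
        ι g₀ + (Es.eval (map (α F.*_) t′) + Es.eval L₂) ≈⟨ +-congˡ (+-cong (Es.eval-scale α t′) (Es.eval-⊞ (F.0# ∷ t′) L₃)) ⟩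
        ι g₀ + (ι α * T + (Es.eval (F.0# ∷ t′) + Es.eval L₃)) ≈⟨ +-congˡ (+-congˡ (+-cong (Es.eval-0∷ t′) (Es.eval-monomial k α))) ⟩
        ι g₀ + (ι α * T + (s * T + ι α * S))        ∎

module LowestOrder {c ℓ} (E : Field c ℓ) {p} (pp : Prime p) (char : Forms.HasChar E p) (q : ℕ) (p≡1+q : p ≡ suc q) where
  private module F = Field E
  open Algebras E
  open TowerNilpotency pp char using (ε-nilpotent; ε^n-torsionFree)
  open EAlgebra (tower q)
  open CommutativeRing R
  open import Algebra.Properties.Semiring.Exp semiring using (_^_; ^-homo-*)
  open import Relation.Binary.Reasoning.Setoid setoid
  open import Algebra.Solver.Ring.NaturalCoefficients.Default commutativeSemiring

  s : Carrier
  s = ε q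

  module Es = Horner (tower q) s

  q<p : q < p
  q<p = ≡.subst (q <_) (≡.sym p≡1+q) (ℕP.n<1+n q)

  s^+ : ∀ a b → s ^ a * s ^ b ≈ s ^ (a ℕ.+ b)
  s^+ a b = sym (^-homo-* s a b)

  s^[1+q+r]≈0 : ∀ r → s ^ (suc q ℕ.+ r) ≈ 0#
  s^[1+q+r]≈0 r = trans (^-homo-* s (suc q) r) (trans (*-congʳ (ε-nilpotent q)) (zeroˡ _))

  private
    split-head : ∀ P a s T S G → P * (((a + s * T) + s * S) * G) ≈ P * (a * G) + (s * P) * ((T + S) * G)
    split-head = solve 6 (λ P a s T S G → P :* (((a :+ s :* T) :+ s :* S) :* G) := P :* (a :* G) :+ (s :* P) :* ((T :+ S) :* G)) refl
    scale-head : ∀ r P a G Y → r * (P * (a * G) + Y) ≈ a * ((r * P) * G) + r * Y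
    scale-head = solve 5 (λ r P a G Y → r :* (P :* (a :* G) :+ Y) := a :* ((r :* P) :* G) :+ r :* Y) refl
    regroup : ∀ r s P Y → r * ((s * P) * Y) ≈ ((r * P) * s) * Y
    regroup = solve 4 (λ r s P Y → r :* ((s :* P) :* Y) := ((r :* P) :* s) :* Y) refl
    regroup₀ : ∀ r P S G → r * (P * ((0# + S) * G)) ≈ (r * (P * S)) * G
    regroup₀ = solve 4 (λ r P S G → r :* (P :* ((con 0 :+ S) :* G)) := (r :* (P :* S)) :* G) refl

  -- If G ≡ d (mod s) with d ≠ 0, the product s^e (t(s) + s^k) G has a nonzero
  -- coefficient in degree ≤ e + k ≤ q, found by peeling off t from the constant term.
  lowest-order≉0 : ∀ k e (t : List F.Carrier) → length t ≤ k → k ℕ.+ e ≤ q → (G : Carrier) (d : F.Carrier) →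
                   ¬ d F.≈ F.0# → s ^ q * G ≈ ι d * s ^ q → ¬ s ^ e * ((Es.eval t + s ^ k) * G) ≈ 0#
  lowest-order≉0 k e [] _ k+e≤q G d d≉0 G≡d vanishes = d≉0 (ε^n-torsionFree q q<p d (begin
    ι d * s ^ q                          ≈⟨ G≡d ⟨
    s ^ q * G                            ≈⟨ *-congʳ (trans (reflexive (≡.cong (s ^_) (≡.sym r+e+k≡q))) (sym (trans (*-congˡ (s^+ e k)) (s^+ r (e ℕ.+ k))))) ⟩
    (s ^ r * (s ^ e * s ^ k)) * G        ≈⟨ regroup₀ _ _ _ _ ⟨
    s ^ r * (s ^ e * ((0# + s ^ k) * G)) ≈⟨ *-congˡ vanishes ⟩
    s ^ r * 0#                           ≈⟨ zeroʳ _ ⟩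
    0#                                   ∎))
    where
    r = q ℕ.∸ (e ℕ.+ k)
    r+e+k≡q : r ℕ.+ (e ℕ.+ k) ≡ q
    r+e+k≡q = ℕP.m∸n+n≡m (≡.subst (ℕ._≤ q) (ℕP.+-comm k e) k+e≤q)
  lowest-order≉0 (suc k) e (t₀ ∷ t) (s≤s len) k+e≤q G d d≉0 G≡d vanishes =
    lowest-order≉0 k (suc e) t len (≡.subst (ℕ._≤ q) (≡.sym (ℕP.+-suc k e)) k+e≤q) G d d≉0 G≡d vanishes′
    where
    r = q ℕ.∸ e
    s^r*s^e≈s^q : s ^ r * s ^ e ≈ s ^ q
    s^r*s^e≈s^q = trans (s^+ r e) (reflexive (≡.cong (s ^_) (ℕP.m∸n+n≡m (ℕP.≤-trans (ℕP.m≤n+m e (suc k)) k+e≤q))))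
    Y = (Es.eval t + s ^ k) * G
    split : s ^ e * ((Es.eval (t₀ ∷ t) + s ^ suc k) * G) ≈ s ^ e * (ι t₀ * G) + s ^ suc e * Y
    split = split-head _ _ _ _ _ _
    tail≈0 : s ^ r * (s ^ suc e * Y) ≈ 0#
    tail≈0 = begin
      s ^ r * ((s * s ^ e) * Y)   ≈⟨ regroup _ _ _ _ ⟩
      ((s ^ r * s ^ e) * s) * Y   ≈⟨ *-congʳ (trans (*-congʳ s^r*s^e≈s^q) (*-comm _ _)) ⟩
      (s * s ^ q) * Y             ≈⟨ *-congʳ (reflexive (≡.cong (s ^_) (≡.sym (ℕP.+-identityʳ (suc q))))) ⟩
      s ^ (suc q ℕ.+ 0) * Y       ≈⟨ *-congʳ (s^[1+q+r]≈0 0) ⟩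
      0# * Y                      ≈⟨ zeroˡ _ ⟩
      0#                          ∎
    t₀d·s^q≈0 : ι (t₀ F.* d) * s ^ q ≈ 0#
    t₀d·s^q≈0 = begin
      ι (t₀ F.* d) * s ^ q                                    ≈⟨ trans (*-congʳ (ι-* t₀ d)) (*-assoc _ _ _) ⟩
      ι t₀ * (ι d * s ^ q)                                    ≈⟨ *-congˡ (trans (sym G≡d) (*-congʳ (sym s^r*s^e≈s^q))) ⟩
      ι t₀ * ((s ^ r * s ^ e) * G)                            ≈⟨ trans (+-congˡ tail≈0) (+-identityʳ _) ⟨
      ι t₀ * ((s ^ r * s ^ e) * G) + s ^ r * (s ^ suc e * Y)  ≈⟨ scale-head _ _ _ _ _ ⟨
      s ^ r * (s ^ e * (ι t₀ * G) + s ^ suc e * Y)            ≈⟨ *-congˡ (trans (sym split) vanishes) ⟩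
      s ^ r * 0#                                              ≈⟨ zeroʳ _ ⟩
      0#                                                      ∎
    t₀≈0 : t₀ F.≈ F.0#
    t₀≈0 with F.inverse d d≉0
    ... | y , dy≈1 = F.trans (F.sym (F.*-identityʳ t₀)) (F.trans (F.*-congˡ (F.sym dy≈1))
                       (F.trans (F.sym (F.*-assoc t₀ d y)) (F.trans (F.*-congʳ (ε^n-torsionFree q q<p _ t₀d·s^q≈0)) (F.zeroˡ y))))
    vanishes′ : s ^ suc e * Y ≈ 0#
    vanishes′ = begin
      s ^ suc e * Y                             ≈⟨ +-identityˡ _ ⟨
      0# + s ^ suc e * Y                        ≈⟨ +-congʳ (sym (trans (*-congˡ (trans (*-congʳ (trans (ι-cong t₀≈0) ι-0)) (zeroˡ G))) (zeroʳ _))) ⟩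
      s ^ e * (ι t₀ * G) + s ^ suc e * Y        ≈⟨ split ⟨
      s ^ e * ((Es.eval (t₀ ∷ t) + s ^ suc k) * G) ≈⟨ vanishes ⟩
      0#                                        ∎

module Division {c ℓ} (E : Field c ℓ) where
  private module F = Field E
  open Algebras E

  Xⁿ : ∀ n → Vec F.Carrier (suc n)
  Xⁿ zero    = F.1# ∷ []
  Xⁿ (suc n) = F.0# ∷ Xⁿ n

  last-Xⁿ : ∀ n → Vec.last (Xⁿ n) ≡ F.1#
  last-Xⁿ zero          = ≡.refl
  last-Xⁿ (suc zero)    = ≡.refl
  last-Xⁿ (suc (suc n)) = last-Xⁿ (suc n)

  toList-∷ : ∀ {n} (v : Vec F.Carrier (suc n)) → toList v ≡ Vec.head v ∷ toList (Vec.tail v)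
  toList-∷ (x ∷ v) = ≡.refl

  toList-zipWith : ∀ {n} (a b : Vec F.Carrier n) → toList (Vec.zipWith F._+_ a b) ≡ toList a ⊞ toList b
  toList-zipWith []      []      = ≡.refl
  toList-zipWith (x ∷ a) (y ∷ b) = ≡.cong ((x F.+ y) ∷_) (toList-zipWith a b)

  -- Long division of X^(m₁ + j) by the monic f = X^(m₁+1) − Σ csᵢ Xⁱ.
  module ByMonic (m₁ : ℕ) (cs : Vec F.Carrier (suc m₁)) where

    f : List F.Carrier
    f = map F.-_ (toList cs) ++ F.1# ∷ []

    remainder : ℕ → Vec F.Carrier (suc m₁)
    remainder zero    = Xⁿ m₁
    remainder (suc j) = Vec.zipWith F._+_ (F.0# ∷ Vec.init (remainder j)) (Vec.map (Vec.last (remainder j) F.*_) cs)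

    quotient : ℕ → List F.Carrier
    quotient zero    = []
    quotient (suc j) = Vec.last (remainder j) ∷ quotient j

    quotient-monic : ∀ j → Σ (List F.Carrier) λ g → (quotient (suc j) ≡ g ++ F.1# ∷ []) × (length g ≡ j)
    quotient-monic zero    = [] , ≡.cong (_∷ []) (last-Xⁿ m₁) , ≡.refl
    quotient-monic (suc j) with quotient-monic j
    ... | g , eq , len = Vec.last (remainder (suc j)) ∷ g , ≡.cong (Vec.last (remainder (suc j)) ∷_) eq , ≡.cong suc len

    module At (A : EAlgebra) (u : CommutativeRing.Carrier (EAlgebra.R A)) where
      open EAlgebra A
      open CommutativeRing R
      open import Algebra.Properties.Semiring.Exp semiring using (_^_)
      open import Relation.Binary.Reasoning.Setoid setoid
      open import Algebra.Solver.Ring.NaturalCoefficients.Default commutativeSemiring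
      open Horner A u public

      evalᵛ : ∀ {n} → Vec F.Carrier n → Carrier
      evalᵛ v = eval (toList v)

      private
        shift-step : ∀ u x I l U → u * x + u * (u * I + l * U) ≈ u * (x + u * I) + l * (u * U)
        shift-step = solve 5 (λ u x I l U → u :* x :+ u :* (u :* I :+ l :* U) := u :* (x :+ u :* I) :+ l :* (u :* U)) refl
        division-step : ∀ u Q F V₀ l C → u * (Q * F) + (V₀ + l * (F + C)) ≈ (l + u * Q) * F + (V₀ + l * C)
        division-step = solve 6 (λ u Q F V₀ l C → u :* (Q :* F) :+ (V₀ :+ l :* (F :+ C)) := (l :+ u :* Q) :* F :+ (V₀ :+ l :* C)) refl

      u*evalᵛ : ∀ {n} (v : Vec F.Carrier (suc n)) → u * evalᵛ v ≈ evalᵛ (F.0# ∷ Vec.init v) + ι (Vec.last v) * u ^ suc n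
      u*evalᵛ (x ∷ []) = begin
        u * (ι x + u * 0#)             ≈⟨ *-congˡ (trans (+-congˡ (zeroʳ u)) (+-identityʳ _)) ⟩
        u * ι x                        ≈⟨ trans (*-comm _ _) (*-congˡ (sym (*-identityʳ u))) ⟩
        ι x * u ^ 1                    ≈⟨ +-identityˡ _ ⟨
        0# + ι x * u ^ 1               ≈⟨ +-congʳ (sym (trans (+-cong ι-0 (zeroʳ u)) (+-identityʳ 0#))) ⟩
        (ι F.0# + u * 0#) + ι x * u ^ 1 ∎
      u*evalᵛ {suc n} (x ∷ y ∷ v) = begin
        u * (ι x + u * evalᵛ (y ∷ v))                                            ≈⟨ distribˡ _ _ _ ⟩
        u * ι x + u * (u * evalᵛ (y ∷ v))                                        ≈⟨ +-congˡ (*-congˡ (u*evalᵛ (y ∷ v))) ⟩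
        u * ι x + u * (evalᵛ (F.0# ∷ Vec.init (y ∷ v)) + ι l * u ^ suc n)        ≈⟨ +-congˡ (*-congˡ (+-congʳ (eval-0∷ (toList (Vec.init (y ∷ v)))))) ⟩
        u * ι x + u * (u * evalᵛ (Vec.init (y ∷ v)) + ι l * u ^ suc n)           ≈⟨ shift-step _ _ _ _ _ ⟩
        u * (ι x + u * evalᵛ (Vec.init (y ∷ v))) + ι l * u ^ suc (suc n)         ≈⟨ +-congʳ (sym (eval-0∷ (toList (x ∷ Vec.init (y ∷ v))))) ⟩
        evalᵛ (F.0# ∷ x ∷ Vec.init (y ∷ v)) + ι l * u ^ suc (suc n)              ∎
        where l = Vec.last (y ∷ v)

      evalᵛ-Xⁿ : ∀ n → evalᵛ (Xⁿ n) ≈ u ^ n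
      evalᵛ-Xⁿ zero    = trans (+-cong ι-1 (zeroʳ u)) (+-identityʳ 1#)
      evalᵛ-Xⁿ (suc n) = trans (eval-0∷ (toList (Xⁿ n))) (*-congˡ (evalᵛ-Xⁿ n))

      u^[1+m₁]≈f+cs : u ^ suc m₁ ≈ eval f + evalᵛ cs
      u^[1+m₁]≈f+cs = begin
        u ^ suc m₁                                   ≈⟨ RingLemmas.x≈x+y-y R _ (- evalᵛ cs) ⟩
        (u ^ suc m₁ - evalᵛ cs) - - evalᵛ cs         ≈⟨ +-cong (+-comm _ _) (RingLemmas.⁻¹-involutive R _) ⟩
        (- evalᵛ cs + u ^ suc m₁) + evalᵛ cs         ≈⟨ +-congʳ (sym (trans (eval-monic (map F.-_ (toList cs))) (+-cong (eval-neg (toList cs)) u^len))) ⟩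
        eval f + evalᵛ cs                            ∎
        where
        u^len : u ^ length (map F.-_ (toList cs)) ≈ u ^ suc m₁
        u^len = reflexive (≡.cong (u ^_) (≡.trans (List.length-map F.-_ (toList cs)) (VecP.length-toList cs)))

      division : ∀ j → u ^ (m₁ ℕ.+ j) ≈ eval (quotient j) * eval f + evalᵛ (remainder j)
      division zero = begin
        u ^ (m₁ ℕ.+ 0)               ≡⟨ ≡.cong (u ^_) (ℕP.+-identityʳ m₁) ⟩
        u ^ m₁                       ≈⟨ evalᵛ-Xⁿ m₁ ⟨
        evalᵛ (Xⁿ m₁)                ≈⟨ trans (+-congʳ (zeroˡ _)) (+-identityˡ _) ⟨
        0# * eval f + evalᵛ (Xⁿ m₁)  ∎
      division (suc j) = begin
        u ^ (m₁ ℕ.+ suc j)                  ≡⟨ ≡.cong (u ^_) (ℕP.+-suc m₁ j) ⟩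
        u * u ^ (m₁ ℕ.+ j)                  ≈⟨ *-congˡ (division j) ⟩
        u * (Q * eval f + evalᵛ Rj)         ≈⟨ distribˡ _ _ _ ⟩
        u * (Q * eval f) + u * evalᵛ Rj     ≈⟨ +-congˡ (u*evalᵛ Rj) ⟩
        u * (Q * eval f) + (V₀ + ι l * u ^ suc m₁)          ≈⟨ +-congˡ (+-congˡ (*-congˡ u^[1+m₁]≈f+cs)) ⟩
        u * (Q * eval f) + (V₀ + ι l * (eval f + evalᵛ cs)) ≈⟨ division-step _ _ _ _ _ _ ⟩
        (ι l + u * Q) * eval f + (V₀ + ι l * evalᵛ cs)      ≈⟨ +-congˡ eval-remainder ⟨
        eval (quotient (suc j)) * eval f + evalᵛ (remainder (suc j)) ∎
        where
        Rj = remainder j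
        Q  = eval (quotient j)
        l  = Vec.last Rj
        V₀ = evalᵛ (F.0# ∷ Vec.init Rj)
        eval-remainder : evalᵛ (remainder (suc j)) ≈ V₀ + ι l * evalᵛ cs
        eval-remainder = begin
          eval (toList (Vec.zipWith F._+_ (F.0# ∷ Vec.init Rj) (Vec.map (l F.*_) cs)))
            ≡⟨ ≡.cong eval (toList-zipWith (F.0# ∷ Vec.init Rj) (Vec.map (l F.*_) cs)) ⟩
          eval (toList (F.0# ∷ Vec.init Rj) ⊞ toList (Vec.map (l F.*_) cs))
            ≈⟨ eval-⊞ (toList (F.0# ∷ Vec.init Rj)) (toList (Vec.map (l F.*_) cs)) ⟩
          V₀ + eval (toList (Vec.map (l F.*_) cs))
            ≡⟨ ≡.cong (λ z → V₀ + eval z) (VecP.toList-map (l F.*_) cs) ⟩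
          V₀ + eval (map (l F.*_) (toList cs))
            ≈⟨ +-congˡ (eval-scale l (toList cs)) ⟩
          V₀ + ι l * evalᵛ cs
            ∎

module PurelyInseparable {c ℓ} (E : Field c ℓ) {p} (pp : Prime p) (char : Forms.HasChar E p) where
  private module F = Field E
  open Algebras E
  open Derivative E
  open Division E
  open Eᵖ-Linear E pp char using (_^_; ×1≉0; char×; x∙y⁻¹≈ε⇒x≈y; inverseˡ-unique; x≈x+y-y; -‿distribˡ-*; -‿distribʳ-*)
  open import Algebra.Properties.Monoid.Mult F.+-monoid using () renaming (_×_ to _×E_)

  record Subfield : Set (lsuc (c ⊔ ℓ)) where
    field
      K      : F.Carrier → Set (c ⊔ ℓ)
      K-cong : ∀ {x y} → x F.≈ y → K x → K y
      K0     : K F.0#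
      K1     : K F.1#
      K+     : ∀ {x y} → K x → K y → K (x F.+ y)
      K*     : ∀ {x y} → K x → K y → K (x F.* y)
      K-     : ∀ {x} → K x → K (F.- x)
      K⁻¹    : ∀ {x} → K x → ¬ x F.≈ F.0# → Σ F.Carrier λ y → K y × (x F.* y F.≈ F.1#)

  module _ (S : Subfield) (α : F.Carrier) (Kαᵖ : Subfield.K S (α ^ p)) where
    open Subfield S
    module Eα = Horner self α

    IndependentPowers : ℕ → Set (c ⊔ ℓ)
    IndependentPowers m = ∀ xs → length xs ≡ m → All K xs → Eα.eval xs F.≈ F.0# → DoubleNegation (All (F._≈ F.0#) xs)

    -- A relation α^(m₁+1) = Σ csᵢ αⁱ of minimal length 1 < m₁ + 1 < p is impossible:
    -- with f = X^(m₁+1) − Σ csᵢ Xⁱ and X^p = Q f + R, minimality forces R = α^p, so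
    -- evaluating at u = α + s in the tower gives Q(u) f(u) = u^p − α^p = 0; but
    -- f(u) = s (f′(α) + O(s)) with f′(α) ≠ 0 and Q(u) = s^k + (lower terms), k < q.
    module NoShortRelation (m₁ : ℕ) (1≤m₁ : 1 ≤ m₁) (m<p : suc m₁ < p) (ind : IndependentPowers (suc m₁))
                           (cs : Vec F.Carrier (suc m₁)) (Kcs : All K (toList cs))
                           (αᵐ≈cs : α ^ suc m₁ F.≈ Eα.eval (toList cs)) where
      open ByMonic m₁ cs
      module Divα = At self α

      q = ℕ.pred p
      p≡1+q : p ≡ suc q
      p≡1+q = PrimeBinomial.prime≡1+pred pp

      open LowestOrder E pp char q p≡1+q using (s; lowest-order≉0; s^[1+q+r]≈0)
      A = tower q
      open EAlgebra A using (ι; ι-cong; ι-0)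
      module T = CommutativeRing (EAlgebra.R A)
      open import Algebra.Properties.Semiring.Exp T.semiring using () renaming (_^_ to _^T_)
      module Taylor = Expansion A α s
      u = Taylor.u
      module Divu = At A u

      m₁≤q : m₁ ≤ q
      m₁≤q = ℕP.<⇒≤ (ℕP.≤-pred (≡.subst (suc (suc m₁) ≤_) p≡1+q m<p))
      k = q ℕ.∸ m₁
      m₁+[1+k]≡p : m₁ ℕ.+ suc k ≡ p
      m₁+[1+k]≡p = ≡.trans (ℕP.+-suc m₁ k) (≡.trans (≡.cong suc (ℕP.m+[n∸m]≡n m₁≤q)) (≡.sym p≡1+q))
      1+k≤q : k ℕ.+ 1 ≤ q
      1+k≤q = ℕP.≤-trans (ℕP.+-monoʳ-≤ k 1≤m₁) (ℕP.≤-reflexive (ℕP.m∸n+n≡m m₁≤q))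

      remainder∈K : ∀ j → All K (toList (remainder j))
      remainder∈K zero    = Xⁿ∈K m₁
        where
        Xⁿ∈K : ∀ n → All K (toList (Xⁿ n))
        Xⁿ∈K zero    = K1 ∷ []
        Xⁿ∈K (suc n) = K0 ∷ Xⁿ∈K n
      remainder∈K (suc j) = zipWith∈K (F.0# ∷ Vec.init Rj) _ (K0 ∷ init∈K Rj (remainder∈K j)) (map∈K cs Kcs)
        where
        Rj = remainder j
        init∈K : ∀ {n} (v : Vec F.Carrier (suc n)) → All K (toList v) → All K (toList (Vec.init v))
        init∈K (x ∷ [])    _          = []
        init∈K (x ∷ y ∷ v) (kx ∷ ks) = kx ∷ init∈K (y ∷ v) ks
        last∈K : ∀ {n} (v : Vec F.Carrier (suc n)) → All K (toList v) → K (Vec.last v)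
        last∈K (x ∷ [])    (kx ∷ _)  = kx
        last∈K (x ∷ y ∷ v) (_ ∷ ks) = last∈K (y ∷ v) ks
        zipWith∈K : ∀ {n} (a b : Vec F.Carrier n) → All K (toList a) → All K (toList b) → All K (toList (Vec.zipWith F._+_ a b))
        zipWith∈K []      []      _          _          = []
        zipWith∈K (x ∷ a) (y ∷ b) (kx ∷ ka) (ky ∷ kb) = K+ kx ky ∷ zipWith∈K a b ka kb
        map∈K : ∀ {n} (a : Vec F.Carrier n) → All K (toList a) → All K (toList (Vec.map (Vec.last Rj F.*_) a))
        map∈K []      _          = []
        map∈K (x ∷ a) (kx ∷ ka) = K* (last∈K Rj (remainder∈K j)) kx ∷ map∈K a ka

      f[α]≈0 : Eα.eval f F.≈ F.0#
      f[α]≈0 = F.trans (x≈x+y-y _ C) (F.trans (F.+-congʳ (F.trans (F.sym Divα.u^[1+m₁]≈f+cs) αᵐ≈cs)) (F.-‿inverseʳ C))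
        where C = Eα.eval (toList cs)

      f∈K : All K f
      f∈K = All.++⁺ (neg∈K Kcs) (K1 ∷ [])
        where
        neg∈K : ∀ {l} → All K l → All K (map F.-_ l)
        neg∈K []         = []
        neg∈K (kx ∷ ks) = K- kx ∷ neg∈K ks

      d = Eα.eval (derivative f)

      f-tail = map F.-_ (toList (Vec.tail cs))

      f-shape : f ≡ (F.- Vec.head cs ∷ f-tail) ++ F.1# ∷ []
      f-shape = ≡.cong (λ xs → map F.-_ xs ++ F.1# ∷ []) (toList-∷ cs)

      length-f-tail : length f-tail ≡ m₁
      length-f-tail = ≡.trans (List.length-map F.-_ (toList (Vec.tail cs))) (VecP.length-toList (Vec.tail cs))

      -- f′ has K-coefficients, length m₁ + 1 and leading coefficient (m₁ + 1)·1 ≠ 0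
      d≉0 : ¬ d F.≈ F.0#
      d≉0 d≈0 with derivative-leading (F.- Vec.head cs) f-tail F.1#
      ... | l′ , f′≡ , len′ =
        ind (derivative f) length-f′ (Closed.derivative-closed K K0 K+ f∈K) d≈0 λ z → ×1≉0 (suc m₁) (s≤s z≤n) m<p (leading≈0 z)
        where
        f′-shape : derivative f ≡ l′ ++ (suc (length f-tail) ×E F.1#) ∷ []
        f′-shape = ≡.trans (≡.cong derivative f-shape) f′≡
        length-f′ : length (derivative f) ≡ suc m₁
        length-f′ = ≡.trans (≡.cong length f′-shape)
                      (≡.trans (List.length-++ l′) (≡.trans (ℕP.+-comm (length l′) 1) (≡.cong suc (≡.trans len′ length-f-tail))))
        leading≈0 : All (F._≈ F.0#) (derivative f) → suc m₁ ×E F.1# F.≈ F.0#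
        leading≈0 z with All.++⁻ l′ (≡.subst (All (F._≈ F.0#)) f′-shape z)
        ... | _ , (lead≈0 ∷ []) = ≡.subst (λ n → suc n ×E F.1# F.≈ F.0#) length-f-tail lead≈0

      Q = quotient (suc k)
      R = remainder (suc k)

      R-shape : toList R ≡ Vec.head R ∷ toList (Vec.tail R)
      R-shape = toList-∷ R

      R′ : List F.Carrier
      R′ = (Vec.head R F.- α ^ p) ∷ toList (Vec.tail R)

      R′∈K : All K R′
      R′∈K with ≡.subst (All K) R-shape (remainder∈K (suc k))
      ... | Kr₀ ∷ Krest = K+ Kr₀ (K- Kαᵖ) ∷ Krest

      R′[α]≈0 : Eα.eval R′ F.≈ F.0#
      R′[α]≈0 = F.trans (F.trans (F.+-assoc _ _ _) (F.trans (F.+-congˡ (F.+-comm _ _)) (F.sym (F.+-assoc _ _ _))))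
                  (F.trans (F.+-congʳ (F.sym αᵖ≈R[α])) (F.-‿inverseʳ _))
        where
        αᵖ≈R[α] : α ^ p F.≈ Eα.eval (Vec.head R ∷ toList (Vec.tail R))
        αᵖ≈R[α] = F.trans (F.reflexive (≡.cong (α ^_) (≡.sym m₁+[1+k]≡p)))
                    (F.trans (Divα.division (suc k))
                    (F.trans (F.+-congʳ (F.trans (F.*-congˡ f[α]≈0) (F.zeroʳ _)))
                    (F.trans (F.+-identityˡ _) (F.reflexive (≡.cong Eα.eval R-shape)))))

      R′≈0⇒R[u]≈αᵖ : All (F._≈ F.0#) R′ → Divu.evalᵛ R T.≈ ι (α ^ p)
      R′≈0⇒R[u]≈αᵖ (r₀-αᵖ≈0 ∷ rest≈0) =
        T.trans (T.reflexive (≡.cong Divu.eval R-shape))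
          (T.trans (T.+-cong (ι-cong (x∙y⁻¹≈ε⇒x≈y _ _ r₀-αᵖ≈0)) (T.trans (T.*-congˡ (eval-zero rest≈0)) (T.zeroʳ u))) (T.+-identityʳ _))
        where
        eval-zero : ∀ {xs} → All (F._≈ F.0#) xs → Divu.eval xs T.≈ T.0#
        eval-zero []           = T.refl
        eval-zero (x≈0 ∷ xs≈0) = T.trans (T.+-cong (T.trans (ι-cong x≈0) ι-0) (T.trans (T.*-congˡ (eval-zero xs≈0)) (T.zeroʳ _))) (T.+-identityʳ _)

      u^p≈αᵖ : u ^T p T.≈ ι (α ^ p)
      u^p≈αᵖ = T.trans (Frobenius.frobenius-+ (EAlgebra.R A) pp (Homomorphism.ι-char A {p} char×) (ι α) s)
                 (T.trans (T.+-cong (T.sym (Homomorphism.ι-^ A α p)) s^p≈0) (T.+-identityʳ _))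
        where
        s^p≈0 : s ^T p T.≈ T.0#
        s^p≈0 = T.trans (T.reflexive (≡.cong (s ^T_) (≡.trans p≡1+q (≡.sym (ℕP.+-identityʳ (suc q)))))) (s^[1+q+r]≈0 0)

      R[u]≈αᵖ⇒Q[u]f[u]≈0 : Divu.evalᵛ R T.≈ ι (α ^ p) → Divu.eval Q T.* Divu.eval f T.≈ T.0#
      R[u]≈αᵖ⇒Q[u]f[u]≈0 R[u]≈αᵖ =
        T.trans (RingLemmas.x≈x+y-y (EAlgebra.R A) _ (ι (α ^ p)))
          (T.trans (T.+-congʳ (T.trans (T.+-congˡ (T.sym R[u]≈αᵖ)) (T.trans (T.sym u^p≈Qf+R) u^p≈αᵖ))) (T.-‿inverseʳ _))
        where
        u^p≈Qf+R : u ^T p T.≈ Divu.eval Q T.* Divu.eval f T.+ Divu.evalᵛ R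
        u^p≈Qf+R = T.trans (T.reflexive (≡.cong (u ^T_) (≡.sym m₁+[1+k]≡p))) (Divu.division (suc k))

      G : T.Carrier
      G = ι d T.+ s T.* proj₁ (Taylor.taylor f)

      f[u]≈sG : Divu.eval f T.≈ s T.* G
      f[u]≈sG = T.trans (proj₂ (Taylor.taylor f)) (T.trans (T.+-congʳ (T.trans (ι-cong f[α]≈0) ι-0)) (T.+-identityˡ _))

      sᵠG≈dsᵠ : s ^T q T.* G T.≈ ι d T.* s ^T q
      sᵠG≈dsᵠ = begin
        s ^T q T.* (ι d T.+ s T.* B)             ≈⟨ T.distribˡ _ _ _ ⟩
        s ^T q T.* ι d T.+ s ^T q T.* (s T.* B)  ≈⟨ T.+-cong (T.*-comm _ _) (T.trans (T.sym (T.*-assoc _ _ _)) (T.trans (T.*-congʳ sᵠs≈0) (T.zeroˡ B))) ⟩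
        ι d T.* s ^T q T.+ T.0#                  ≈⟨ T.+-identityʳ _ ⟩
        ι d T.* s ^T q                           ∎
        where
        open import Relation.Binary.Reasoning.Setoid T.setoid
        B = proj₁ (Taylor.taylor f)
        sᵠs≈0 : s ^T q T.* s T.≈ T.0#
        sᵠs≈0 = T.trans (T.*-comm _ _) (TowerNilpotency.ε-nilpotent pp char q)

      g = proj₁ (quotient-monic k)
      t = proj₁ (Taylor.monic-shift g)

      Q[u]≈t+sᵏ : Divu.eval Q T.≈ Taylor.Es.eval t T.+ s ^T length g
      Q[u]≈t+sᵏ = T.trans (T.reflexive (≡.cong Divu.eval (proj₁ (proj₂ (quotient-monic k)))))
                    (T.trans (Divu.eval-monic g) (proj₂ (proj₂ (Taylor.monic-shift g))))

      no-short-relation : ⊥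
      no-short-relation = ind R′ (≡.cong suc (VecP.length-toList (Vec.tail R))) R′∈K R′[α]≈0 λ R′≈0 →
        lowest-order≉0 (length g) 1 t t≤g 1+g≤q G d d≉0 sᵠG≈dsᵠ (s·Q[u]·G≈0 (R[u]≈αᵖ⇒Q[u]f[u]≈0 (R′≈0⇒R[u]≈αᵖ R′≈0)))
        where
        t≤g : length t ≤ length g
        t≤g = proj₁ (proj₂ (Taylor.monic-shift g))
        1+g≤q : length g ℕ.+ 1 ≤ q
        1+g≤q = ≡.subst (λ n → n ℕ.+ 1 ≤ q) (≡.sym (proj₂ (proj₂ (quotient-monic k)))) 1+k≤q
        s·Q[u]·G≈0 : Divu.eval Q T.* Divu.eval f T.≈ T.0# → s ^T 1 T.* ((Taylor.Es.eval t T.+ s ^T length g) T.* G) T.≈ T.0#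
        s·Q[u]·G≈0 Qf≈0 =
          T.trans (T.*-congʳ (T.*-identityʳ s))
            (T.trans (RingLemmas.*-left-comm (EAlgebra.R A) _ _ _) (T.trans (T.*-cong (T.sym Q[u]≈t+sᵏ) (T.sym f[u]≈sG)) Qf≈0))

    private
      snoc-view : ∀ {a} {X : Set a} {m} (xs : List X) → length xs ≡ suc m →
                  Σ (List X) λ ys → Σ X λ y → (xs ≡ ys ++ y ∷ []) × (length ys ≡ m)
      snoc-view {m = zero}  (x ∷ []) _  = [] , x , ≡.refl , ≡.refl
      snoc-view {m = suc m} (x ∷ xs) eq with snoc-view {m = m} xs (ℕP.suc-injective eq)
      ... | ys , y , ≡.refl , len = x ∷ ys , y , ≡.refl , ≡.cong suc len

      toVec : ∀ {a} {X : Set a} {n} (l : List X) → length l ≡ n → Σ (Vec X n) λ v → toList v ≡ l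
      toVec {n = zero}  []      _  = [] , ≡.refl
      toVec {n = suc n} (x ∷ l) eq with toVec {n = n} l (ℕP.suc-injective eq)
      ... | v , ≡.refl = x ∷ v , ≡.refl

    eval-snoc : ∀ ys y → Eα.eval (ys ++ y ∷ []) F.≈ Eα.eval ys F.+ α ^ length ys F.* y
    eval-snoc ys y = F.trans (Eα.eval-++ ys (y ∷ [])) (F.+-congˡ (F.*-congˡ Eα.eval-[ y ]))

    eval-snoc-zero : ∀ ys {y} → y F.≈ F.0# → Eα.eval (ys ++ y ∷ []) F.≈ Eα.eval ys
    eval-snoc-zero ys {y} y≈0 = F.trans (eval-snoc ys y) (F.trans (F.+-congˡ (F.trans (F.*-congˡ y≈0) (F.zeroʳ _))) (F.+-identityʳ _))

    normalise : ∀ ys {y} → All K (ys ++ y ∷ []) → ¬ y F.≈ F.0# → Eα.eval (ys ++ y ∷ []) F.≈ F.0# →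
                Σ (List F.Carrier) λ cs → All K cs × length cs ≡ length ys × α ^ length ys F.≈ Eα.eval cs
    normalise ys {y} K[ys∷y] y≉0 relation with All.++⁻ʳ ys K[ys∷y]
    ... | Ky ∷ [] with K⁻¹ Ky y≉0
    ... | y⁻¹ , Ky⁻¹ , yy⁻¹≈1 = map (F.- y⁻¹ F.*_) ys , scale∈K (All.++⁻ˡ ys K[ys∷y]) , List.length-map _ ys , (begin
      α ^ length ys                         ≈⟨ F.trans (F.*-congˡ yy⁻¹≈1) (F.*-identityʳ _) ⟨
      α ^ length ys F.* (y F.* y⁻¹)         ≈⟨ F.*-assoc _ _ _ ⟨
      (α ^ length ys F.* y) F.* y⁻¹         ≈⟨ F.*-congʳ (inverseˡ-unique _ _ (F.trans (F.+-comm _ _) (F.trans (F.sym (eval-snoc ys y)) relation))) ⟩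
      (F.- Eα.eval ys) F.* y⁻¹              ≈⟨ -‿distribˡ-* _ _ ⟨
      F.- (Eα.eval ys F.* y⁻¹)              ≈⟨ -‿distribʳ-* _ _ ⟩
      Eα.eval ys F.* (F.- y⁻¹)              ≈⟨ F.*-comm _ _ ⟩
      (F.- y⁻¹) F.* Eα.eval ys              ≈⟨ Eα.eval-scale (F.- y⁻¹) ys ⟨
      Eα.eval (map (F.- y⁻¹ F.*_) ys)       ∎)
      where
      open import Relation.Binary.Reasoning.Setoid F.setoid
      scale∈K : ∀ {l} → All K l → All K (map (F.- y⁻¹ F.*_) l)
      scale∈K []         = []
      scale∈K (kx ∷ ks) = K* (K- Ky⁻¹) kx ∷ scale∈K ks

    no-relation : ¬ K α → ∀ m → 1 ≤ m → m < p → IndependentPowers m →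
                  ∀ cs → length cs ≡ m → All K cs → ¬ α ^ m F.≈ Eα.eval cs
    no-relation α∉K (suc zero) _ _ _ (c₀ ∷ []) _ (Kc₀ ∷ []) α¹≈c₀ =
      α∉K (K-cong (F.sym (F.trans (F.sym (F.*-identityʳ α)) (F.trans α¹≈c₀ (F.trans (F.+-congˡ (F.zeroʳ α)) (F.+-identityʳ c₀))))) Kc₀)
    no-relation α∉K (suc (suc m₁)) _ m<p ind cs len Kcs αᵐ≈cs with toVec cs len
    ... | v , ≡.refl = NoShortRelation.no-short-relation (suc m₁) (s≤s z≤n) m<p ind v Kcs αᵐ≈cs

    powers-independent : ¬ K α → IndependentPowers p
    powers-independent α∉K = up-to p (PrimeBinomial.prime⇒0< pp) ℕP.≤-refl
      where
      independent₁ : IndependentPowers 1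
      independent₁ (x ∷ []) _ _ x≈0 = λ k → k (F.trans (F.sym (F.trans (F.+-congˡ (F.zeroʳ α)) (F.+-identityʳ x))) x≈0 ∷ [])

      step : ∀ m → 1 ≤ m → m < p → IndependentPowers m → IndependentPowers (suc m)
      step m 1≤m m<p ind xs len Kxs xs≈0 with snoc-view xs len
      ... | ys , y , ≡.refl , ≡.refl = ¬¬-excluded-middle >>= λ where
          (yes y≈0) → ¬¬-map (λ z → All.++⁺ z (y≈0 ∷ []))
                        (ind ys ≡.refl (All.++⁻ˡ ys Kxs) (F.trans (F.sym (eval-snoc-zero ys y≈0)) xs≈0))
          (no y≉0) → case normalise ys Kxs y≉0 xs≈0 of λ where
            (cs , Kcs , len-cs , αᵐ≈cs) → ⊥-elim (no-relation α∉K m 1≤m m<p ind cs len-cs Kcs αᵐ≈cs)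

      up-to : ∀ m → 1 ≤ m → m ≤ p → IndependentPowers m
      up-to (suc zero)    _ _  = independent₁
      up-to (suc (suc m)) _ le = step (suc m) (s≤s z≤n) le (up-to (suc m) (s≤s z≤n) (ℕP.<⇒≤ le))

module PfisterSpan {c ℓ} (E : Field c ℓ) {p : ℕ} (pp : Prime p) (char : Forms.HasChar E p) where
  open Field E hiding (zero)
  open Eᵖ-Linear E pp char
  open PurelyInseparable E pp char using (Subfield; IndependentPowers; powers-independent)
  open Algebras E using (module Horner; self)
  open import Relation.Binary.Reasoning.Setoid setoid

  open Forms E using (_⊗_)

  pf1 : Carrier → List Carrier
  pf1 = Forms.pf1 E p

  pfister : List Carrier → List Carrier
  pfister = Forms.pfister E p

  ∈-⊗ : ∀ {x y} X Y → Any (x ≈_) X → Any (y ≈_) Y → Any ((x * y) ≈_) (X ⊗ Y)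
  ∈-⊗ {x} {y} (w ∷ X) Y (here x≈w) y∈Y =
    Any.++⁺ˡ (Any.map⁺ (Any.map (λ y≈ → trans (*-congʳ x≈w) (*-congˡ y≈)) y∈Y))
  ∈-⊗ (w ∷ X) Y (there x∈X) y∈Y = Any.++⁺ʳ (map (w *_) Y) (∈-⊗ X Y x∈X y∈Y)

  all-⊗ : ∀ {P : Carrier → Set (c ⊔ ℓ)} X Y → All (λ x → All (λ y → P (x * y)) Y) X → All P (X ⊗ Y)
  all-⊗ []      Y []         = []
  all-⊗ (x ∷ X) Y (Px ∷ PX) = All.++⁺ (All.map⁺ Px) (all-⊗ X Y PX)

  length-⊗ : ∀ X Y → length (X ⊗ Y) ≡ length X ℕ.* length Y
  length-⊗ []      Y = ≡.refl
  length-⊗ (x ∷ X) Y = ≡.trans (List.length-++ (map (x *_) Y)) (≡.cong₂ ℕ._+_ (List.length-map _ Y) (length-⊗ X Y))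

  span-*ʳ : ∀ M {v} X → All (λ x → InSpan M (x * v)) X → ∀ {u} → InSpan X u → InSpan M (u * v)
  span-*ʳ M {v} []      _            (xs , u≈) = span-cong (sym (trans (*-congʳ u≈) (zeroˡ v))) span-0
  span-*ʳ M {v} (x ∷ X) _            ([] , u≈) = span-cong (sym (trans (*-congʳ u≈) (zeroˡ v))) span-0
  span-*ʳ M {v} (x ∷ X) (xv∈M ∷ Xv∈M) (a ∷ as , u≈) =
    span-cong (sym (trans (*-congʳ u≈) (trans (distribʳ v _ _) (+-congʳ (*-assoc _ _ _)))))
      (span-+ (span-scale a xv∈M) (span-*ʳ M X Xv∈M (as , refl)))

  span-* : ∀ M X Y → All (λ x → All (λ y → InSpan M (x * y)) Y) X → ∀ {u v} → InSpan X u → InSpan Y v → InSpan M (u * v)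
  span-* M X Y XY⊆M {u} {v} u∈X v∈Y = span-*ʳ M X
    (All.map (λ {x} xY⊆M → span-cong (*-comm v x) (span-*ʳ M Y (All.map (λ {y} → span-cong (*-comm x y)) xY⊆M) v∈Y)) XY⊆M) u∈X

  span-⊗ : ∀ X Y {u v} → InSpan X u → InSpan Y v → InSpan (X ⊗ Y) (u * v)
  span-⊗ X Y = span-* (X ⊗ Y) X Y
    (All.map (λ x∈X → All.map (λ y∈Y → span-∈ (∈-⊗ X Y x∈X y∈Y)) (∈-self Y)) (∈-self X))

  ⊗-monoʳ : ∀ X {Y Y′} → All (InSpan Y′) Y → All (InSpan (X ⊗ Y′)) (X ⊗ Y)
  ⊗-monoʳ X {Y} Y⊆Y′ = all-⊗ X Y (All.map (λ x∈X → All.map (span-⊗ X _ (span-∈ x∈X)) Y⊆Y′) (∈-self X))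

  MulClosed : List Carrier → Set (c ⊔ ℓ)
  MulClosed L = All (λ x → All (λ y → InSpan L (x * y)) L) L

  ⊗-mulClosed : ∀ X Y → MulClosed X → MulClosed Y → MulClosed (X ⊗ Y)
  ⊗-mulClosed X Y mcX mcY = all-⊗ X Y (All.map (λ {x} xX⊆X → All.map (λ {y} yY⊆Y →
      all-⊗ X Y (All.map (λ {x′} xx′∈X → All.map (λ {y′} yy′∈Y →
        span-cong (sym (*-interchange x y x′ y′)) (span-⊗ X Y xx′∈X yy′∈Y)) yY⊆Y) xX⊆X)) mcY) mcX)

  mulClosed-transfer : ∀ P Q → MulClosed P → All (InSpan P) Q → All (InSpan Q) P → MulClosed Q
  mulClosed-transfer P Q mcP Q⊆P P⊆Q =
    All.map (λ x∈P → All.map (λ y∈P → span-trans P⊆Q (span-* P P P mcP x∈P y∈P)) Q⊆P) Q⊆P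

  αᵏ∈pf1 : ∀ α k → k < p → Any ((α ^ k) ≈_) (pf1 α)
  αᵏ∈pf1 α k k<p = ≡.subst (Any ((α ^ k) ≈_)) (≡.sym (List.map-upTo (Forms.pow E α) p))
                     (Any.applyUpTo⁺ (Forms.pow E α) (reflexive (≡.sym (pow≡^ α k))) k<p)

  all-pf1 : ∀ {P : Carrier → Set (c ⊔ ℓ)} α → (∀ k → k < p → P (α ^ k)) → All P (pf1 α)
  all-pf1 {P} α Pαᵏ = ≡.subst (All P) (≡.sym (List.map-upTo (Forms.pow E α) p))
                        (All.applyUpTo⁺₁ (Forms.pow E α) p (λ {k} k<p → ≡.subst P (≡.sym (pow≡^ α k)) (Pαᵏ k k<p)))

  length-pf1 : ∀ α → length (pf1 α) ≡ p
  length-pf1 α = ≡.trans (List.length-map _ (upTo p)) (List.length-upTo p)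

  -- α^(i+j) = (α^p)·α^(i+j−p) lies in the E^p-span when i + j ≥ p
  pf1-mulClosed : ∀ α → MulClosed (pf1 α)
  pf1-mulClosed α = all-pf1 α (λ i i<p → all-pf1 α (λ j j<p → αⁱαʲ∈ i j i<p j<p))
    where
    αⁱαʲ∈ : ∀ i j → i < p → j < p → InSpan (pf1 α) (α ^ i * α ^ j)
    αⁱαʲ∈ i j i<p j<p with i ℕ.+ j ℕ.<? p
    ... | yes i+j<p = span-cong (^-homo-* α i j) (span-∈ (αᵏ∈pf1 α (i ℕ.+ j) i+j<p))
    ... | no  i+j≮p = span-cong (begin
            α ^ p * α ^ r    ≈⟨ ^-homo-* α p r ⟨
            α ^ (p ℕ.+ r)    ≡⟨ ≡.cong (α ^_) p+r≡i+j ⟩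
            α ^ (i ℕ.+ j)    ≈⟨ ^-homo-* α i j ⟩
            α ^ i * α ^ j    ∎) (span-scale α (span-∈ (αᵏ∈pf1 α r r<p)))
      where
      r = i ℕ.+ j ℕ.∸ p
      p+r≡i+j : p ℕ.+ r ≡ i ℕ.+ j
      p+r≡i+j = ℕP.m+[n∸m]≡n (ℕP.≮⇒≥ i+j≮p)
      r<p : r < p
      r<p = ℕP.+-cancelˡ-< p r p (≡.subst (ℕ._< p ℕ.+ p) (≡.sym p+r≡i+j) (ℕP.+-mono-< i<p j<p))

  1∈pfister : ∀ αs → InSpan (pfister αs) 1#
  1∈pfister []       = span-∈ (here refl)
  1∈pfister (α ∷ αs) = span-cong (*-identityˡ 1#)
    (span-⊗ (pf1 α) (pfister αs) (span-∈ (αᵏ∈pf1 α 0 (PrimeBinomial.prime⇒0< pp))) (1∈pfister αs))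

  pfister-mulClosed : ∀ αs → MulClosed (pfister αs)
  pfister-mulClosed []       = (span-∈ (here (*-identityʳ 1#)) ∷ []) ∷ []
  pfister-mulClosed (α ∷ αs) = ⊗-mulClosed (pf1 α) (pfister αs) (pf1-mulClosed α) (pfister-mulClosed αs)

  weighted-sum : List Carrier → List Carrier → Carrier
  weighted-sum (x ∷ X) (c ∷ cs) = x * c + weighted-sum X cs
  weighted-sum _       _        = 0#

  comb-⊗ : ∀ X Q xs → length xs ≡ length X ℕ.* length Q →
    Σ (List (List Carrier)) λ xss → (xs ≡ concat xss) × All (λ ys → length ys ≡ length Q) xss ×
      (length xss ≡ length X) × (comb (X ⊗ Q) xs ≈ weighted-sum X (map (comb Q) xss))
  comb-⊗ []      Q [] _   = [] , ≡.refl , [] , ≡.refl , refl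
  comb-⊗ (x ∷ X) Q xs len with split-at (length Q) xs (≡.subst (length Q ≤_) (≡.sym len) (ℕP.m≤m+n _ _))
  ... | xs₀ , xs₁ , ≡.refl , len₀
    with comb-⊗ X Q xs₁ (ℕP.+-cancelˡ-≡ (length Q) _ _
           (≡.trans (≡.cong (ℕ._+ length xs₁) (≡.sym len₀)) (≡.trans (≡.sym (List.length-++ xs₀)) len)))
  ... | xss , ≡.refl , lens , len-xss , comb≈ = xs₀ ∷ xss , ≡.refl , len₀ ∷ lens , ≡.cong suc len-xss , (begin
    comb (map (x *_) Q ++ (X ⊗ Q)) (xs₀ ++ concat xss)        ≈⟨ comb-++ (map (x *_) Q) (X ⊗ Q) xs₀ _ (≡.trans len₀ (≡.sym (List.length-map _ Q))) ⟩
    comb (map (x *_) Q) xs₀ + comb (X ⊗ Q) (concat xss)       ≈⟨ +-cong (comb-mapˡ x Q xs₀) comb≈ ⟩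
    x * comb Q xs₀ + weighted-sum X (map (comb Q) xss)        ∎)

  ⊗-independent : ∀ X Q → Independent Q →
    (∀ cs → length cs ≡ length X → All (InSpan Q) cs → weighted-sum X cs ≈ 0# → DoubleNegation (All (_≈ 0#) cs)) →
    Independent (X ⊗ Q)
  ⊗-independent X Q indQ indX xs len comb≈0 with comb-⊗ X Q xs (≡.trans len (length-⊗ X Q))
  ... | xss , ≡.refl , lens , len-xss , comb≈ =
    indX (map (comb Q) xss) (≡.trans (List.length-map _ xss) len-xss) (spans xss) (trans (sym comb≈) comb≈0) >>= λ blocks≈0 →
    ¬¬-map All.concat⁺ (¬¬-all (each xss lens blocks≈0))
    where
    spans : ∀ yss → All (InSpan Q) (map (comb Q) yss)
    spans []         = []
    spans (ys ∷ yss) = (ys , refl) ∷ spans yss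
    each : ∀ yss → All (λ ys → length ys ≡ length Q) yss → All (_≈ 0#) (map (comb Q) yss) →
           All (λ ys → DoubleNegation (All (_≈ 0#) ys)) yss
    each []         []           []         = []
    each (ys ∷ yss) (len ∷ lens) (z ∷ zs) = indQ ys len z ∷ each yss lens zs

  weighted-sum-pf1 : ∀ α cs → length cs ≡ p → weighted-sum (pf1 α) cs ≈ Horner.eval self α cs
  weighted-sum-pf1 α cs len =
    trans (reflexive (≡.cong (λ X → weighted-sum X cs) (List.map-upTo (Forms.pow E α) p)))
          (trans (shifted p (Forms.pow E α) 0 (λ i → reflexive (pow≡^ α i)) cs len) (*-identityˡ _))
    where
    shifted : ∀ n (g : ℕ → Carrier) j → (∀ i → g i ≈ α ^ (j ℕ.+ i)) → ∀ cs → length cs ≡ n →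
              weighted-sum (applyUpTo g n) cs ≈ α ^ j * Horner.eval self α cs
    shifted zero    g j g≈ []       _   = sym (zeroʳ _)
    shifted (suc n) g j g≈ (c ∷ cs) len = begin
      g 0 * c + weighted-sum (applyUpTo (λ i → g (suc i)) n) cs
        ≈⟨ +-cong (*-congʳ (trans (g≈ 0) (reflexive (≡.cong (α ^_) (ℕP.+-identityʳ j)))))
                  (shifted n (λ i → g (suc i)) (suc j) (λ i → trans (g≈ (suc i)) (reflexive (≡.cong (α ^_) (ℕP.+-suc j i)))) cs (ℕP.suc-injective len)) ⟩
      α ^ j * c + α ^ suc j * Horner.eval self α cs         ≈⟨ +-congˡ (trans (*-congʳ (*-comm α _)) (*-assoc _ _ _)) ⟩
      α ^ j * c + α ^ j * (α * Horner.eval self α cs)       ≈⟨ distribˡ _ _ _ ⟨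
      α ^ j * (c + α * Horner.eval self α cs)               ∎

  -- The E^p-span of a multiplicatively closed list containing 1 is a field, inverses
  -- coming from v⁻¹ = (v⁻¹)^p v^(p-1).
  spanSubfield : ∀ Q → MulClosed Q → InSpan Q 1# → Subfield
  spanSubfield Q mcQ 1∈Q = record
    { K = InSpan Q ; K-cong = span-cong ; K0 = span-0 ; K1 = 1∈Q
    ; K+ = span-+ ; K* = span-* Q Q Q mcQ ; K- = span-neg ; K⁻¹ = inverse∈ }
    where
    ^∈ : ∀ {v} → InSpan Q v → ∀ k → InSpan Q (v ^ k)
    ^∈ v∈Q zero    = 1∈Q
    ^∈ v∈Q (suc k) = span-* Q Q Q mcQ v∈Q (^∈ v∈Q k)
    q = ℕ.pred p
    inverse∈ : ∀ {v} → InSpan Q v → ¬ v ≈ 0# → Σ Carrier λ y → InSpan Q y × (v * y ≈ 1#)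
    inverse∈ {v} v∈Q v≉0 with inverse v v≉0
    ... | y , vy≈1 = y , span-cong yᵖvᵠ≈y (span-scale y (^∈ v∈Q q)) , vy≈1
      where
      yᵖvᵠ≈y : y ^ p * v ^ q ≈ y
      yᵖvᵠ≈y = begin
        y ^ p * v ^ q          ≡⟨ ≡.cong (λ n → y ^ n * v ^ q) (PrimeBinomial.prime≡1+pred pp) ⟩
        (y * y ^ q) * v ^ q    ≈⟨ *-assoc _ _ _ ⟩
        y * (y ^ q * v ^ q)    ≈⟨ *-congˡ (^-distrib-* y v q) ⟨
        y * (y * v) ^ q        ≈⟨ *-congˡ (^-congˡ q (trans (*-comm y v) vy≈1)) ⟩
        y * 1# ^ q             ≈⟨ *-congˡ (1^n q) ⟩
        y * 1#                 ≈⟨ *-identityʳ y ⟩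
        y                      ∎

  record PfisterBasis (αs : List Carrier) : Set (c ⊔ ℓ) where
    field
      basis       : List Carrier
      k           : ℕ
      k≤n         : k ≤ length αs
      length≡p^k  : length basis ≡ p ℕ.^ k
      independent : Independent basis
      pfister⊆    : All (InSpan basis) (pfister αs)
      ⊆pfister    : All (InSpan (pfister αs)) basis

  pfister-basis : ∀ αs → DoubleNegation (PfisterBasis αs)
  pfister-basis []       = λ ¬B → ¬B (record
    { basis = 1# ∷ [] ; k = 0 ; k≤n = z≤n ; length≡p^k = ≡.refl ; independent = independent-[1]
    ; pfister⊆ = span-self (1# ∷ []) ; ⊆pfister = span-self (1# ∷ []) })
    where
    independent-[1] : Independent (1# ∷ [])
    independent-[1] (x ∷ []) _ xᵖ≈0 = ¬¬-map (_∷ []) (^p≈0⇒¬¬≈0 x (trans (sym (trans (+-identityʳ _) (*-identityʳ _))) xᵖ≈0))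
  pfister-basis (α ∷ αs) = pfister-basis αs >>= λ B → ¬¬-excluded-middle >>= λ where
      (yes α∈Q) → λ ¬B → ¬B (record
        { basis = basis B ; k = k B ; k≤n = ℕP.m≤n⇒m≤1+n (k≤n B) ; length≡p^k = length≡p^k B
        ; independent = independent B ; pfister⊆ = α∈Q⇒pfister⊆ B α∈Q ; ⊆pfister = ⊆pfister-∷ B })
      (no α∉Q) → λ ¬B → ¬B (record
        { basis = pf1 α ⊗ basis B ; k = suc (k B) ; k≤n = s≤s (k≤n B)
        ; length≡p^k = ≡.trans (length-⊗ (pf1 α) (basis B)) (≡.cong₂ ℕ._*_ (length-pf1 α) (length≡p^k B))
        ; independent = ⊗-independent (pf1 α) (basis B) (independent B) (powers-independent-over B α∉Q)
        ; pfister⊆ = ⊗-monoʳ (pf1 α) (pfister⊆ B) ; ⊆pfister = ⊗-monoʳ (pf1 α) (⊆pfister B) })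
    where
    open PfisterBasis
    subfield : PfisterBasis αs → Subfield
    subfield B = spanSubfield (basis B)
      (mulClosed-transfer (pfister αs) (basis B) (pfister-mulClosed αs) (⊆pfister B) (pfister⊆ B))
      (span-trans (pfister⊆ B) (1∈pfister αs))
    α∈Q⇒pfister⊆ : ∀ B → InSpan (basis B) α → All (InSpan (basis B)) (pfister (α ∷ αs))
    α∈Q⇒pfister⊆ B α∈Q = all-⊗ (pf1 α) (pfister αs) (all-pf1 α (λ i _ →
      All.map (Subfield.K* (subfield B) (^∈ i)) (pfister⊆ B)))
      where
      ^∈ : ∀ i → InSpan (basis B) (α ^ i)
      ^∈ zero    = Subfield.K1 (subfield B)
      ^∈ (suc i) = Subfield.K* (subfield B) α∈Q (^∈ i)
    ⊆pfister-∷ : ∀ B → All (InSpan (pfister (α ∷ αs))) (basis B)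
    ⊆pfister-∷ B = All.map (λ {v} v∈ → span-cong (*-identityˡ v)
      (span-⊗ (pf1 α) (pfister αs) (span-∈ (αᵏ∈pf1 α 0 (PrimeBinomial.prime⇒0< pp))) v∈)) (⊆pfister B)
    powers-independent-over : ∀ B → ¬ InSpan (basis B) α →
      ∀ cs → length cs ≡ length (pf1 α) → All (InSpan (basis B)) cs → weighted-sum (pf1 α) cs ≈ 0# → DoubleNegation (All (_≈ 0#) cs)
    powers-independent-over B α∉Q cs len cs∈Q sum≈0 =
      powers-independent (subfield B) α (span-cong (*-identityʳ _) (span-scale α (Subfield.K1 (subfield B)))) α∉Q
        cs p≡ cs∈Q (trans (sym (weighted-sum-pf1 α cs p≡)) sum≈0)
      where p≡ = ≡.trans len (length-pf1 α)

module FormSpan {c ℓ} (K : Field c ℓ) {p} (pp : Prime p) (char : Forms.HasChar K p) where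
  open Field K hiding (zero)
  open Eᵖ-Linear K pp char
  open Forms K using (eval; apply; pow; Σᶠ; Isometric; Anisotropic; IsZeroVec)

  eval-cong : ∀ φ {x y : Fin (length φ) → Carrier} → (∀ i → x i ≈ y i) → eval p φ x ≈ eval p φ y
  eval-cong φ x≈y = Σᶠ-cong (λ i → *-congˡ (pow-cong p (x≈y i)))
    where
    Σᶠ-cong : ∀ {n} {f g : Fin n → Carrier} → (∀ i → f i ≈ g i) → Σᶠ f ≈ Σᶠ g
    Σᶠ-cong {zero}  _   = refl
    Σᶠ-cong {suc n} f≈g = +-cong (f≈g zero) (Σᶠ-cong (λ i → f≈g (suc i)))
    pow-cong : ∀ {x y} k → x ≈ y → pow x k ≈ pow y k
    pow-cong zero    _   = refl
    pow-cong (suc k) x≈y = *-cong x≈y (pow-cong k x≈y)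

  eval≈comb : ∀ φ (x : Fin (length φ) → Carrier) → eval p φ x ≈ comb φ (tabulate x)
  eval≈comb []      x = refl
  eval≈comb (v ∷ φ) x = +-cong (trans (*-comm v _) (*-congʳ (reflexive (pow≡^ (x zero) p)))) (eval≈comb φ (λ i → x (suc i)))

  unit : ∀ {n} → Fin n → Fin n → Carrier
  unit zero    zero    = 1#
  unit zero    (suc i) = 0#
  unit (suc j) zero    = 0#
  unit (suc j) (suc i) = unit j i

  eval-zero : ∀ φ → eval p φ (λ _ → 0#) ≈ 0#
  eval-zero []      = refl
  eval-zero (v ∷ φ) = trans (+-cong (trans (*-congˡ (trans (reflexive (pow≡^ 0# p)) 0^p)) (zeroʳ v)) (eval-zero φ)) (+-identityʳ 0#)

  eval-unit : ∀ φ j → eval p φ (unit j) ≈ lookup φ j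
  eval-unit (v ∷ φ) zero    = trans (+-cong (trans (*-congˡ (trans (reflexive (pow≡^ 1# p)) (1^n p))) (*-identityʳ v)) (eval-zero φ)) (+-identityʳ v)
  eval-unit (v ∷ φ) (suc j) = trans (+-cong (trans (*-congˡ (trans (reflexive (pow≡^ 0# p)) 0^p)) (zeroʳ v)) (eval-unit φ j)) (+-identityˡ _)

  eval∈span : ∀ φ x → InSpan φ (eval p φ x)
  eval∈span φ x = tabulate x , eval≈comb φ x

  all-lookup : ∀ {P : Carrier → Set (c ⊔ ℓ)} L → (∀ i → P (lookup L i)) → All P L
  all-lookup []      _   = []
  all-lookup (v ∷ L) P[] = P[] zero ∷ all-lookup L (λ i → P[] (suc i))

  isometric⇒⊆ : ∀ φ ψ → Isometric p φ ψ → All (InSpan ψ) φ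
  isometric⇒⊆ φ ψ (M , N , NM , MN , preserves) = all-lookup φ (λ j →
    span-cong (trans (preserves (unit j)) (eval-unit φ j)) (eval∈span ψ (apply M (unit j))))

  isometric⇒⊇ : ∀ φ ψ → Isometric p φ ψ → All (InSpan φ) ψ
  isometric⇒⊇ φ ψ (M , N , NM , MN , preserves) = all-lookup ψ (λ j →
    span-cong (trans (sym (preserves (apply N (unit j)))) (trans (eval-cong ψ (MN (unit j))) (eval-unit ψ j)))
      (eval∈span φ (apply N (unit j))))

  anisotropic⇒independent : ∀ ψ → Anisotropic p ψ → Independent ψ
  anisotropic⇒independent ψ aniso xs len comb≈0 = λ ¬z →
    ¬z (zeros (aniso (as-vector xs len) (trans (eval≈comb ψ _) (trans (reflexive (≡.cong (comb ψ) (tabulate-as-vector xs len))) comb≈0))))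
    where
    as-vector : ∀ {n} (xs : List Carrier) → length xs ≡ n → Fin n → Carrier
    as-vector {suc n} (x ∷ xs) _  zero    = x
    as-vector {suc n} (x ∷ xs) eq (suc i) = as-vector xs (ℕP.suc-injective eq) i
    tabulate-as-vector : ∀ {n} xs (eq : length xs ≡ n) → tabulate (as-vector xs eq) ≡ xs
    tabulate-as-vector {zero}  []       _  = ≡.refl
    tabulate-as-vector {suc n} (x ∷ xs) eq = ≡.cong (x ∷_) (tabulate-as-vector xs (ℕP.suc-injective eq))
    zeros : IsZeroVec (as-vector xs len) → All (_≈ 0#) xs
    zeros = go xs len
      where
      go : ∀ {n} xs (eq : length xs ≡ n) → IsZeroVec (as-vector xs eq) → All (_≈ 0#) xs
      go {zero}  []       _  _ = []
      go {suc n} (x ∷ xs) eq z = z zero ∷ go xs (ℕP.suc-injective eq) (λ i → z (suc i))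

module BaseChange {c ℓ c′ ℓ′} (F : Field c ℓ) (L : Extension F c′ ℓ′) {p} (pp : Prime p) (charF : Forms.HasChar F p) where
  open Extension L public using (E; ι)
  private
    module F = Field F
    module E = Field E
  open RingMorphisms.IsRingHomomorphism (Extension.isHom L)
    using () renaming (⟦⟧-cong to ι-cong; +-homo to ι-+; *-homo to ι-*; 0#-homo to ι-0; 1#-homo to ι-1)
  module PF = Eᵖ-Linear F pp charF

  ι-×1 : ∀ n → ι (Forms._×1 F n) E.≈ Forms._×1 E n
  ι-×1 zero    = ι-0
  ι-×1 (suc n) = E.trans (ι-+ _ _) (E.+-cong ι-1 (ι-×1 n))

  charE : Forms.HasChar E p
  charE = E.trans (E.sym (ι-×1 p)) (E.trans (ι-cong charF) ι-0)

  module PE = Eᵖ-Linear E pp charE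

  ι-pow : ∀ x k → ι (Forms.pow F x k) E.≈ Forms.pow E (ι x) k
  ι-pow x zero    = ι-1
  ι-pow x (suc k) = E.trans (ι-* _ _) (E.*-congˡ (ι-pow x k))

  ι-^ : ∀ x k → ι (x PF.^ k) E.≈ ι x PE.^ k
  ι-^ x zero    = ι-1
  ι-^ x (suc k) = E.trans (ι-* _ _) (E.*-congˡ (ι-^ x k))

  ι-comb : ∀ M xs → ι (PF.comb M xs) E.≈ PE.comb (map ι M) (map ι xs)
  ι-comb []      xs       = ι-0
  ι-comb (w ∷ M) []       = ι-0
  ι-comb (w ∷ M) (x ∷ xs) = E.trans (ι-+ _ _) (E.+-cong (E.trans (ι-* _ _) (E.*-congʳ (ι-^ x p))) (ι-comb M xs))

  ι-span : ∀ {M v} → PF.InSpan M v → PE.InSpan (map ι M) (ι v)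
  ι-span {M} (PF._,_ xs v≈) = PE._,_ (map ι xs) (E.trans (ι-cong v≈) (ι-comb M xs))

  map-⊆ : ∀ {M As} → All (PF.InSpan M) As → All (PE.InSpan (map ι M)) (map ι As)
  map-⊆ []             = []
  map-⊆ (a∈M ∷ As⊆M) = ι-span a∈M ∷ map-⊆ As⊆M

  pointwise⇒⊆ : ∀ {A B} → Pointwise E._≈_ A B → All (PE.InSpan B) A
  pointwise⇒⊆ {A} {B} A≈B = All.map PE.span-∈ (go A≈B)
    where
    go : ∀ {A B} → Pointwise E._≈_ A B → All (λ v → Any (v E.≈_) B) A
    go []          = []
    go (a≈b ∷ A≈B) = here a≈b ∷ All.map there (go A≈B)

  map-⊗ : ∀ X X′ Y Y′ → Pointwise E._≈_ (map ι X) X′ → Pointwise E._≈_ (map ι Y) Y′ →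
          Pointwise E._≈_ (map ι (Forms._⊗_ F X Y)) (Forms._⊗_ E X′ Y′)
  map-⊗ []      []        Y Y′ []          _   = []
  map-⊗ (x ∷ X) (x′ ∷ X′) Y Y′ (x≈ ∷ X≈) Y≈ =
    ≡.subst (λ Z → Pointwise E._≈_ Z _) (≡.sym (List.map-++ ι (map (x F.*_) Y) (Forms._⊗_ F X Y)))
      (Pointwise.++⁺ (scaled Y Y′ Y≈) (map-⊗ X X′ Y Y′ X≈ Y≈))
    where
    scaled : ∀ Y Y′ → Pointwise E._≈_ (map ι Y) Y′ → Pointwise E._≈_ (map ι (map (x F.*_) Y)) (map (x′ E.*_) Y′)
    scaled []      []        []          = []
    scaled (y ∷ Y) (y′ ∷ Y′) (y≈ ∷ Y≈) = E.trans (ι-* x y) (E.*-cong x≈ y≈) ∷ scaled Y Y′ Y≈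

  map-pfister : ∀ as → Pointwise E._≈_ (map ι (Forms.pfister F p as)) (Forms.pfister E p (map ι as))
  map-pfister []       = ι-1 ∷ []
  map-pfister (a ∷ as) = map-⊗ (Forms.pf1 F p a) (Forms.pf1 E p (ι a)) (Forms.pfister F p as) (Forms.pfister E p (map ι as))
                           (map-pf1 (upTo p)) (map-pfister as)
    where
    map-pf1 : ∀ ns → Pointwise E._≈_ (map ι (map (Forms.pow F a) ns)) (map (Forms.pow E (ι a)) ns)
    map-pf1 []       = []
    map-pf1 (n ∷ ns) = ι-pow a n ∷ map-pf1 ns

open import Data.Nat using (_+_; _^_)

module Decomposition (p D s : ℕ) where

  DecomposesAt : ℕ → Set
  DecomposesAt k = Σ ℕ λ l → l ≤ s × D ≡ p ^ k + l

  Decomposes : ℕ → Set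
  Decomposes n = Σ ℕ λ k → Σ ℕ λ l → k ≤ n × l ≤ s × D ≡ p ^ k + l

  decomposesAt? : ∀ k → Dec (DecomposesAt k)
  decomposesAt? k with p ^ k ≤? D
  ... | no  pᵏ≰D = no λ { (l , _ , D≡) → pᵏ≰D (≡.subst (p ^ k ≤_) (≡.sym D≡) (ℕP.m≤m+n _ _)) }
  ... | yes pᵏ≤D with D ∸ p ^ k ≤? s
  ...   | yes l≤s = yes (D ∸ p ^ k , l≤s , ≡.sym (ℕP.m+[n∸m]≡n pᵏ≤D))
  ...   | no  l≰s = no λ { (l , l≤s , D≡) → l≰s (≡.subst (_≤ s) (≡.sym (≡.trans (≡.cong (_∸ p ^ k) D≡) (ℕP.m+n∸m≡n (p ^ k) l))) l≤s) }

  decomposes? : ∀ n → Dec (Decomposes n)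
  decomposes? zero with decomposesAt? 0
  ... | yes (l , l≤s , D≡) = yes (0 , l , z≤n , l≤s , D≡)
  ... | no ¬at0            = no λ { (zero , l , _ , l≤s , D≡) → ¬at0 (l , l≤s , D≡) }
  decomposes? (suc n) with decomposes? n | decomposesAt? (suc n)
  ... | yes (k , l , k≤n , l≤s , D≡) | _                  = yes (k , l , ℕP.m≤n⇒m≤1+n k≤n , l≤s , D≡)
  ... | no _                         | yes (l , l≤s , D≡) = yes (suc n , l , ℕP.≤-refl , l≤s , D≡)
  ... | no ¬below                    | no ¬at             =
    no λ { (k , l , k≤1+n , l≤s , D≡) → below-or-at (ℕP.m≤n⇒m<n∨m≡n k≤1+n) (l , l≤s , D≡) }
    where
    below-or-at : ∀ {k} → k < suc n ⊎ k ≡ suc n → ¬ DecomposesAt k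
    below-or-at (inj₁ k<1+n)  (l , l≤s , D≡) = ¬below (_ , l , ℕP.≤-pred k<1+n , l≤s , D≡)
    below-or-at (inj₂ ≡.refl) at             = ¬at at

  between⇒decomposes : ∀ {n k} → k ≤ n → p ^ k ≤ D → D ≤ p ^ k + s → Decomposes n
  between⇒decomposes {k = k} k≤n pᵏ≤D D≤pᵏ+s =
    k , D ∸ p ^ k , k≤n , ℕP.≤-trans (ℕP.∸-monoˡ-≤ (p ^ k) D≤pᵏ+s) (ℕP.≤-reflexive (ℕP.m+n∸m≡n (p ^ k) s)) , ≡.sym (ℕP.m+[n∸m]≡n pᵏ≤D)

module AnisotropicPart {c ℓ c′ ℓ′} (F : Field c ℓ) (L : Extension F c′ ℓ′) {p} (pp : Prime p) (charF : Forms.HasChar F p)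
  {n} (as : Vec (Field.Carrier F) n) (π σ φ : Forms.QForm F) (d : Field.Carrier F)
  (pfister≅π : Forms.Isometric F p (Forms.pfister F p (toList as)) π)
  (φ≅π⊥dσ : Forms.Isometric F p φ (Forms._⊥_ F π (Forms._·_ F d σ)))
  (ψ : Forms.QForm (Extension.E L)) (m : ℕ)
  (φE≅ψ⊥0 : Forms.Isometric (Extension.E L) p (baseChange L φ) (Forms._⊥_ (Extension.E L) ψ (Forms.zeros (Extension.E L) m)))
  (ψ-aniso : Forms.Anisotropic (Extension.E L) p ψ) where

  open BaseChange F L pp charF
  open PE using (InSpan; ⊆-trans; ⊆-++ˡ; ⊆-++ʳ; span-self; steinitz)
  open PfisterSpan E pp charE using (pfister-basis; PfisterBasis)
  open PfisterBasis
  open Decomposition p (length ψ) (length σ)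

  αs = map ι (toList as)
  dσE = map ι (Forms._·_ F d σ)
  πE = map ι π
  φE = map ι φ
  pfF = Forms.pfister F p (toList as)
  pfE = Forms.pfister E p αs
  π⊥dσ = Forms._⊥_ F π (Forms._·_ F d σ)

  ψ⊆φE : All (InSpan φE) ψ
  ψ⊆φE = All.++⁻ˡ ψ (FormSpan.isometric⇒⊇ E pp charE φE (ψ ++ Forms.zeros E m) φE≅ψ⊥0)

  φE⊆ψ : All (InSpan ψ) φE
  φE⊆ψ = ⊆-trans (FormSpan.isometric⇒⊆ E pp charE φE (ψ ++ Forms.zeros E m) φE≅ψ⊥0) (All.++⁺ (span-self ψ) (zeros⊆ m))
    where
    zeros⊆ : ∀ k → All (InSpan ψ) (Forms.zeros E k)
    zeros⊆ zero    = []
    zeros⊆ (suc k) = PE.span-0 ∷ zeros⊆ k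

  φE⊆πE++dσE : All (InSpan (πE ++ dσE)) φE
  φE⊆πE++dσE = ≡.subst (λ X → All (InSpan X) φE) (List.map-++ ι π _) (map-⊆ (FormSpan.isometric⇒⊆ F pp charF φ π⊥dσ φ≅π⊥dσ))

  πE⊆φE : All (InSpan φE) πE
  πE⊆φE = All.++⁻ˡ πE (≡.subst (All (InSpan φE)) (List.map-++ ι π _) (map-⊆ (FormSpan.isometric⇒⊇ F pp charF φ π⊥dσ φ≅π⊥dσ)))

  pfE⊆πE : All (InSpan πE) pfE
  pfE⊆πE = ⊆-trans (pointwise⇒⊆ (Pointwise.symmetric (Field.sym E) (map-pfister (toList as))))
                   (map-⊆ (FormSpan.isometric⇒⊆ F pp charF pfF π pfister≅π))

  πE⊆pfE : All (InSpan pfE) πE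
  πE⊆pfE = ⊆-trans (map-⊆ (FormSpan.isometric⇒⊇ F pp charF pfF π pfister≅π)) (pointwise⇒⊆ (map-pfister (toList as)))

  module _ (B : PfisterBasis αs) where

    basis⊆ψ : All (InSpan ψ) (basis B)
    basis⊆ψ = ⊆-trans (⊆pfister B) (⊆-trans pfE⊆πE (⊆-trans πE⊆φE φE⊆ψ))

    ψ⊆basis++dσE : All (InSpan (basis B ++ dσE)) ψ
    ψ⊆basis++dσE = ⊆-trans ψ⊆φE (⊆-trans φE⊆πE++dσE
      (All.++⁺ (⊆-trans πE⊆pfE (⊆-trans (pfister⊆ B) (⊆-++ˡ (basis B) dσE))) (⊆-++ʳ (basis B) dσE)))

    k≤n′ : k B ≤ n
    k≤n′ = ℕP.≤-trans (k≤n B) (ℕP.≤-reflexive (≡.trans (List.length-map ι (toList as)) (VecP.length-toList as)))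

    length-basis++dσE : length (basis B ++ dσE) ≡ p ^ k B + length σ
    length-basis++dσE = ≡.trans (List.length-++ (basis B))
      (≡.cong₂ _+_ (length≡p^k B) (≡.trans (List.length-map ι (Forms._·_ F d σ)) (List.length-map _ σ)))

  ¬¬-decomposes : DoubleNegation (Decomposes n)
  ¬¬-decomposes =
    pfister-basis αs >>= λ B →
    steinitz (independent B) (basis⊆ψ B) >>= λ pᵏ≤dimψ →
    steinitz (FormSpan.anisotropic⇒independent E pp charE ψ ψ-aniso) (ψ⊆basis++dσE B) >>= λ dimψ≤ →
    λ ¬decomposes → ¬decomposes (between⇒decomposes (k≤n′ B)
      (≡.subst (_≤ length ψ) (length≡p^k B) pᵏ≤dimψ) (≡.subst (length ψ ≤_) (length-basis++dσE B) dimψ≤))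

corollary4p9 : ∀ {c ℓ : Level} (F : Field c ℓ) (p : ℕ) → Prime p → Forms.HasChar F p →
    (n : ℕ) (π σ φ : Forms.QForm F) (d : Field.Carrier F) →
    Forms.IsQuasiPfister F p n π →
    Forms.Subform F p σ π →
    ¬ (Field._≈_ F d (Field.0# F)) →
    Forms.Isometric F p φ (Forms._⊥_ F π (Forms._·_ F d σ)) →
    Forms.Anisotropic F p φ →
    ∀ {c' ℓ' : Level} (L : Extension F c' ℓ') (ψ : Forms.QForm (Extension.E L)) (m : ℕ) →
    Forms.Isometric (Extension.E L) p (baseChange L φ) (Forms._⊥_ (Extension.E L) ψ (Forms.zeros (Extension.E L) m)) →
    Forms.Anisotropic (Extension.E L) p ψ →
    Σ ℕ λ k → Σ ℕ λ l → k ≤ n × l ≤ Forms.dim F σ × Forms.dim (Extension.E L) ψ ≡ p ^ k + l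
corollary4p9 F p pp charF n π σ φ d (as , pfister≅π) _ _ φ≅π⊥dσ _ L ψ m φE≅ψ⊥0 ψ-aniso =
  decidable-stable (Decomposition.decomposes? p (length ψ) (length σ) n)
    (AnisotropicPart.¬¬-decomposes F L pp charF as π σ φ d pfister≅π φ≅π⊥dσ ψ m φE≅ψ⊥0 ψ-aniso)
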